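{- For every finite simple graph $\mathbf g$, $\Psi_{\bullet-\bullet}(\mathbf g)=\sum_{K\in L^{\bullet-\bullet}_{\mathbf g}}\nu^{\bullet-\bullet}_{\mathbf g}(K)\,p_{\lambda(K)}.$
   Context: Let $V$ be the vertex set of $\mathbf g$, $n=|V|$. $\Psi_{\bullet-\bullet}(\mathbf g)=\sum_{a\models n}c_a(\mathbf g)M_a$, where for a composition $a=(a_1,\dots,a_\ell)$ of $n$, $c_a(\mathbf g)$ is the number of ordered set partitions $(B_1,\dots,B_\ell)$ of $V$ with $|B_i|=a_i$ such that each induced subgraph $\mathbf g|_{B_i}$ is a perfect matching (a disjoint union of edges covering $B_i$ with no further edges), and $M_a=\sum_{i_1<\dots<i_\ell}x_{i_1}^{a_1}\cdots x_{i_\ell}^{a_\ell}$. The poset $L^{\bullet-\bullet}_{\mathbf g}$ consists of the set partitions $K$ of $V$ such that $K$ is coarser than (or equal to) the set partition of $V$ into the pairs of some perfect matching of $\mathbf g$, and the induced subgraph of $\mathbf g$ on each block of $K$ is connected; it is ordered by refinement. Its minimal elements are the set partitions given by perfect matchings of $\mathbf g$. The function $\nu^{\bullet-\bullet}_{\mathbf g}$ on $L^{\bullet-\bullet}_{\mathbf g}$ is defined by $\nu(\pi)=1$ for every minimal element $\pi$, and for every other $K$ by the condition $\sum_{K'\le K}\nu(K')=0$, the sum over elements $K'$ of $L^{\bullet-\bullet}_{\mathbf g}$ below or equal to $K$. $\lambda(K)$ is the integer partition formed by the block sizes of $K$, and $p_\lambda$ is the power sum symmetric function. (If $n$ is odd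 or $\mathbf g$ has no perfect matching, both sides are $0$.) -}

module Defs where

open import Data.Bool using (Bool; true; false; _∧_; _∨_; not; if_then_else_; T)
open import Data.Nat using (ℕ; zero; suc; _+_; _≡ᵇ_; _<ᵇ_)
open import Data.Fin using (Fin; toℕ) renaming (zero to fz; suc to fs)
open import Data.List using (List; []; _∷_; map; _++_; concatMap; allFin; filterᵇ; length; lookup; foldr)
open import Data.Bool.ListAction using (all; any)
open import Data.Integer using (ℤ; +_; _*_) renaming (_+_ to _+ℤ_)
open import Data.Product using (_×_)
open import Relation.Binary.PropositionalEquality using (_≡_)
open import Relation.Nullary using (¬_)

record SimpleGraph (n : ℕ) : Set where
  field
    adj    : Fin n → Fin n → Bool
    sym    : ∀ x y → adj x y ≡ adj y x
    irrefl : ∀ x → adj x x ≡ false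
open SimpleGraph public

_==F_ : ∀ {n} → Fin n → Fin n → Bool
x ==F y = toℕ x ≡ᵇ toℕ y

_⇒ᵇ_ : Bool → Bool → Bool
a ⇒ᵇ b = not a ∨ b

countFin : (n : ℕ) → (Fin n → Bool) → ℕ
countFin n p = length (filterᵇ p (allFin n))

allF : (n : ℕ) → (Fin n → Bool) → Bool
allF n p = all p (allFin n)

anyF : (n : ℕ) → (Fin n → Bool) → Bool
anyF n p = any p (allFin n)

sumℕ : List ℕ → ℕ
sumℕ = foldr _+_ 0

sumℤ : List ℤ → ℤ
sumℤ = foldr _+ℤ_ (+ 0)

cons : ∀ {n} {A : Set} → A → (Fin n → A) → Fin (suc n) → A
cons a f fz = a
cons a f (fs i) = f i

allFuns : (n : ℕ) {A : Set} → List A → List (Fin n → A)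
allFuns zero    xs = (λ ()) ∷ []
allFuns (suc n) xs = concatMap (λ a → map (cons a) (allFuns n xs)) xs

_==L_ : List ℕ → List ℕ → Bool
[] ==L [] = true
(x ∷ xs) ==L (y ∷ ys) = (x ≡ᵇ y) ∧ (xs ==L ys)
_ ==L _ = false

-- Monomials x^α, α = (α₁,…,α_N) an exponent vector in variables x₁…x_N.
-- A (quasi)symmetric function in countably many variables is determined by
-- its coefficients at all such monomials; we compare these coefficients.

stripZeros : List ℕ → List ℕ
stripZeros [] = []
stripZeros (zero ∷ xs) = stripZeros xs
stripZeros (suc k ∷ xs) = suc k ∷ stripZeros xs

-- coefficient of x^α in the monomial quasisymmetric function M_a
coeffM : List ℕ → List ℕ → ℤ
coeffM a α = if stripZeros α ==L a then + 1 else + 0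

incHead : List ℕ → List ℕ
incHead [] = []
incHead (k ∷ ks) = suc k ∷ ks

compositions : ℕ → List (List ℕ)
compositions zero = [] ∷ []
compositions (suc zero) = (1 ∷ []) ∷ []
compositions (suc (suc m)) =
  map (1 ∷_) (compositions (suc m)) ++ map incHead (compositions (suc m))

-- coefficient of x^α in the power sum p_μ = p_{μ₁} ⋯ p_{μ_k}:
-- the number of ways to pick, for each factor j, a variable h(j)
-- such that the product of the x_{h(j)}^{μ_j} equals x^α
coeffP : List ℕ → List ℕ → ℤ
coeffP μ α = + length (filterᵇ ok (allFuns (length μ) (allFin (length α))))
  where
  ok : (Fin (length μ) → Fin (length α)) → Bool
  ok h = allF (length α) λ i →
           sumℕ (map (lookup μ) (filterᵇ (λ j → h j ==F i) (allFin (length μ))))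
             ≡ᵇ lookup α i

-- Ψ_{•-•}(g) = Σ_{a ⊨ n} c_a(g) M_a

module _ {n : ℕ} (g : SimpleGraph n) where

  -- f : V → Fin ℓ encodes the ordered set partition (B₁,…,B_ℓ), B_i = f⁻¹(i).
  -- g|_{B_i} is a perfect matching iff every vertex of B_i has exactly one
  -- neighbour inside B_i.
  okOrdered : (a : List ℕ) → (Fin n → Fin (length a)) → Bool
  okOrdered a f =
    allF (length a) (λ i → countFin n (λ v → f v ==F i) ≡ᵇ lookup a i)
    ∧ allF n (λ v → countFin n (λ u → (f u ==F f v) ∧ adj g v u) ≡ᵇ 1)

  c : List ℕ → ℕ
  c a = length (filterᵇ (okOrdered a) (allFuns n (allFin (length a))))

  coeffΨ : List ℕ → ℤ
  coeffΨ α = sumℤ (map (λ a → + c a * coeffM a α) (compositions n))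

-- Set partitions of V = Fin n, represented (uniquely) by their
-- equivalence relations as Boolean matrices.

Rel : ℕ → Set
Rel n = Fin n → Fin n → Bool

isEquiv : ∀ {n} → Rel n → Bool
isEquiv {n} K =
  allF n (λ x → K x x)
  ∧ allF n (λ x → allF n (λ y → K x y ⇒ᵇ K y x))
  ∧ allF n (λ x → allF n (λ y → allF n (λ z → (K x y ∧ K y z) ⇒ᵇ K x z)))

allRels : (n : ℕ) → List (Rel n)
allRels n = allFuns n (allFuns n (true ∷ false ∷ []))

setPartitions : (n : ℕ) → List (Rel n)
setPartitions n = filterᵇ isEquiv (allRels n)

-- refinement order: K' ≤ K  (K' finer than or equal to K)
_⊑_ : ∀ {n} → Rel n → Rel n → Bool
_⊑_ {n} K' K = allF n (λ x → allF n (λ y → K' x y ⇒ᵇ K x y))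

_==R_ : ∀ {n} → Rel n → Rel n → Bool
K ==R K' = (K ⊑ K') ∧ (K' ⊑ K)

-- λ(K): block sizes, one entry per block (listed at its least element)
blockSizes : ∀ {n} → Rel n → List ℕ
blockSizes {n} K =
  map (λ x → countFin n (K x))
      (filterᵇ (λ x → not (anyF n (λ y → (toℕ y <ᵇ toℕ x) ∧ K x y))) (allFin n))

module _ {n : ℕ} (g : SimpleGraph n) where

  isMatchingPartition : Rel n → Bool
  isMatchingPartition M =
    isEquiv M
    ∧ allF n (λ x → countFin n (M x) ≡ᵇ 2)
    ∧ allF n (λ x → allF n (λ y → (M x y ∧ not (x ==F y)) ⇒ᵇ adj g x y))

  -- reach k K x y : y reachable from x by a walk of length ≤ k in g
  -- all of whose vertices lie in the block of x in K
  reach : ℕ → Rel n → Fin n → Fin n → Bool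
  reach zero    K x y = x ==F y
  reach (suc k) K x y =
    reach k K x y ∨ anyF n (λ z → reach k K x z ∧ K x y ∧ adj g z y)

  blocksConnected : Rel n → Bool
  blocksConnected K = allF n (λ x → allF n (λ y → K x y ⇒ᵇ reach n K x y))

  inL : Rel n → Bool
  inL K = isEquiv K
          ∧ anyF′ (λ M → isMatchingPartition M ∧ (M ⊑ K))
          ∧ blocksConnected K
    where
    anyF′ : (Rel n → Bool) → Bool
    anyF′ p = any p (allRels n)

  Lgg : List (Rel n)
  Lgg = filterᵇ inL (allRels n)

  isMinimalL : Rel n → Bool
  isMinimalL K = inL K ∧ all (λ K' → (K' ⊑ K) ⇒ᵇ (K' ==R K)) Lgg

  IsNu : (Rel n → ℤ) → Set
  IsNu ν =
    (∀ K → T (isMinimalL K) → ν K ≡ + 1)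
    × (∀ K → T (inL K) → ¬ T (isMinimalL K) →
         sumℤ (map ν (filterᵇ (λ K' → K' ⊑ K) Lgg)) ≡ + 0)

  coeffRHS : (Rel n → ℤ) → List ℕ → ℤ
  coeffRHS ν α = sumℤ (map (λ K → ν K * coeffP (blockSizes K) α) Lgg)

-- Compare the coefficients of a monomial x^α. On the left, only the composition obtained from α
-- by deleting its zero entries contributes, and its coefficient counts the colourings
-- f : V → {1,…,N} with colour classes of sizes α in which every vertex has exactly one neighbour
-- of its own colour, i.e. every colour class induces a perfect matching. On the right, the
-- coefficient of x^α in p_λ(K) counts the colourings with classes of sizes α that are constant
-- on the blocks of K, i.e. with K ≤ ker f. Exchanging the two sums, it remains to show that
-- Σ_{K ∈ L, K ≤ ker f} ν(K) is 1 if f is such a matching colouring and 0 otherwise. In the first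
-- case the monochromatic edges form the only element of L below ker f, and it is minimal. In the
-- second case either nothing in L lies below ker f, or the partition Q of V into the connected
-- components of the colour classes lies in L, is not minimal, and has the same elements of L
-- below it as ker f, so the recursion defining ν makes the sum vanish.

module Submission where

open import Defs hiding (sym; irrefl)
open import Algebra.Bundles using (CommutativeSemigroup)
import Algebra.Properties.CommutativeSemigroup as CommutativeSemigroupProperties
open import Algebra.Structures using (IsCommutativeSemiring)
open import Data.Bool using (Bool; true; false; T; _∧_; _∨_; not; if_then_else_)
open import Data.Bool.Properties using (T-∧; T-∨; T-≡)
import Data.Bool.Properties as Boolᴾ
open import Data.Bool.ListAction using (any)
open import Data.Empty using (⊥-elim)
open import Data.Fin using (Fin; toℕ) renaming (zero to fz; suc to fs)
import Data.Fin.Properties as FinP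
open import Data.Integer using (ℤ; +_) renaming (_+_ to _+ℤ_; _*_ to _*ℤ_)
import Data.Integer.Properties as ℤP
open import Data.List using (List; []; _∷_; map; _++_; concatMap; allFin; filterᵇ; length; foldr; lookup)
open import Data.List.Membership.Propositional using (_∈_; find; lose)
open import Data.List.Membership.Propositional.Properties using (∈-allFin; ∈-filter⁺; ∈-filter⁻)
open import Data.List.Properties using (map-∘; map-tabulate; length-tabulate; length-filter)
open import Data.List.Relation.Unary.All using (All; []; _∷_)
import Data.List.Relation.Unary.All as All
import Data.List.Relation.Unary.All.Properties as AllP
open import Data.List.Relation.Unary.AllPairs.Core using (_∷_)
open import Data.List.Relation.Unary.Any using (Any; here; there)
import Data.List.Relation.Unary.Any as Any
open import Data.List.Relation.Unary.Any.Properties using (any⁺; any⁻)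
open import Data.List.Relation.Unary.Unique.Propositional using (Unique)
import Data.List.Relation.Unary.Unique.Propositional.Properties as UniqueP
open import Data.Nat using (ℕ; zero; suc; _+_; _*_; _∸_; _≡ᵇ_; _<ᵇ_; _≤_; _<_; z≤n; s≤s)
import Data.Nat.Properties as ℕP
open import Data.Product using (_×_; _,_; proj₁; proj₂; ∃-syntax)
open import Data.Sum using (_⊎_; inj₁; inj₂; [_,_]′)
open import Function using (_∘_; id; const; _⇔_; mk⇔)
open import Function.Bundles using (module Equivalence)
open import Relation.Binary.PropositionalEquality
  using (_≡_; _≢_; refl; sym; trans; cong; cong₂; subst; module ≡-Reasoning)
open import Relation.Binary.Core using (_⇒_)
open import Relation.Binary.Structures using (IsEquivalence)
open import Relation.Binary.Definitions using (tri<; tri≈; tri>)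
open import Relation.Nullary using (¬_; Dec; yes; no)
open import Relation.Nullary.Decidable using (T?; ⌊_⌋; toWitness; fromWitness)

open AllP using (all⁺; all⁻)
open Equivalence using (to; from)

T-injective : ∀ {a b} → (T a → T b) → (T b → T a) → a ≡ b
T-injective {true}  {true}  _ _ = refl
T-injective {true}  {false} f _ = ⊥-elim (f _)
T-injective {false} {true}  _ g = ⊥-elim (g _)
T-injective {false} {false} _ _ = refl

¬T⇒≡false : ∀ {b} → ¬ T b → b ≡ false
¬T⇒≡false {true}  ¬b = ⊥-elim (¬b _)
¬T⇒≡false {false} _  = refl

not≡false⇒T : ∀ {b} → not b ≡ false → T b
not≡false⇒T {true} _ = _

T-not⁺ : ∀ {b} → ¬ T b → T (not b)
T-not⁺ {true}  ¬b = ¬b _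
T-not⁺ {false} _  = _

T-not⁻ : ∀ {b} → T (not b) → ¬ T b
T-not⁻ {true} () _

⇒ᵇ⁺ : ∀ {a b} → (T a → T b) → T (a ⇒ᵇ b)
⇒ᵇ⁺ {true}  f = from T-∨ (inj₂ (f _))
⇒ᵇ⁺ {false} f = _

⇒ᵇ⁻ : ∀ {a b} → T (a ⇒ᵇ b) → T a → T b
⇒ᵇ⁻ {true} h _ = h

module _ {n : ℕ} where

  ==F⇒≡ : {x y : Fin n} → T (x ==F y) → x ≡ y
  ==F⇒≡ {x} {y} p = FinP.toℕ-injective (ℕP.≡ᵇ⇒≡ (toℕ x) (toℕ y) p)

  ≡⇒==F : {x y : Fin n} → x ≡ y → T (x ==F y)
  ≡⇒==F {x} refl = ℕP.≡⇒≡ᵇ (toℕ x) (toℕ x) refl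

  ==F-sym : (x y : Fin n) → (x ==F y) ≡ (y ==F x)
  ==F-sym x y = T-injective (λ p → ≡⇒==F (sym (==F⇒≡ {x} {y} p)))
                            (λ p → ≡⇒==F (sym (==F⇒≡ {y} {x} p)))

  allF⁺ : {p : Fin n → Bool} → (∀ i → T (p i)) → T (allF n p)
  allF⁺ {p} h = all⁻ p {allFin n} (All.tabulate (λ {i} _ → h i))

  allF⁻ : {p : Fin n → Bool} → T (allF n p) → ∀ i → T (p i)
  allF⁻ {p} h i = All.lookup (all⁺ p (allFin n) h) (∈-allFin i)

  allF-cong : {p q : Fin n → Bool} → (∀ i → p i ≡ q i) → allF n p ≡ allF n q
  allF-cong e = T-injective (λ h → allF⁺ (λ i → subst T (e i) (allF⁻ h i)))
                            (λ h → allF⁺ (λ i → subst T (sym (e i)) (allF⁻ h i)))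

  anyF⁺ : {p : Fin n → Bool} (i : Fin n) → T (p i) → T (anyF n p)
  anyF⁺ {p} i pi = any⁺ p (Any.map (λ { refl → pi }) (∈-allFin i))

  anyF⁻ : {p : Fin n → Bool} → T (anyF n p) → ∃[ i ] T (p i)
  anyF⁻ {p} h = Any.satisfied (any⁻ p (allFin n) h)

-- Finite sums in a commutative semiring

module ListSum {A : Set} {_+_ _*_ : A → A → A} {0# 1# : A}
               (isCS : IsCommutativeSemiring _≡_ _+_ _*_ 0# 1#) where

  open IsCommutativeSemiring isCS using
    (+-assoc; +-identityˡ; *-assoc; *-identityˡ; zeroˡ; zeroʳ; distribˡ; distribʳ)

  private
    +-commutativeSemigroup : CommutativeSemigroup _ _
    +-commutativeSemigroup =
      record { isCommutativeSemigroup = IsCommutativeSemiring.+-isCommutativeSemigroup isCS }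

  open CommutativeSemigroupProperties +-commutativeSemigroup using (interchange)

  private variable
    B C : Set

  ∑ : List B → (B → A) → A
  ∑ xs f = foldr _+_ 0# (map f xs)

  𝟙 : Bool → A
  𝟙 b = if b then 1# else 0#

  𝟙-∧ : ∀ a b → 𝟙 (a ∧ b) ≡ 𝟙 a * 𝟙 b
  𝟙-∧ true  b = sym (*-identityˡ (𝟙 b))
  𝟙-∧ false b = sym (zeroˡ (𝟙 b))

  ∑-cong∈ : (xs : List B) {f g : B → A} → (∀ {x} → x ∈ xs → f x ≡ g x) → ∑ xs f ≡ ∑ xs g
  ∑-cong∈ []       e = refl
  ∑-cong∈ (x ∷ xs) e = cong₂ _+_ (e (here refl)) (∑-cong∈ xs (e ∘ there))

  ∑-cong : (xs : List B) {f g : B → A} → (∀ x → f x ≡ g x) → ∑ xs f ≡ ∑ xs g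
  ∑-cong xs e = ∑-cong∈ xs (λ {x} _ → e x)

  ∑-0 : (xs : List B) → ∑ xs (const 0#) ≡ 0#
  ∑-0 []       = refl
  ∑-0 (x ∷ xs) = trans (+-identityˡ _) (∑-0 xs)

  ∑-vanishes : (xs : List B) {f : B → A} → (∀ {x} → x ∈ xs → f x ≡ 0#) → ∑ xs f ≡ 0#
  ∑-vanishes xs e = trans (∑-cong∈ xs e) (∑-0 xs)

  ∑-+ : (xs : List B) (f g : B → A) → ∑ xs (λ x → f x + g x) ≡ ∑ xs f + ∑ xs g
  ∑-+ []       f g = sym (+-identityˡ 0#)
  ∑-+ (x ∷ xs) f g = trans (cong₂ _+_ refl (∑-+ xs f g)) (interchange (f x) (g x) (∑ xs f) (∑ xs g))

  ∑-*ˡ : (xs : List B) (c : A) (f : B → A) → ∑ xs (λ x → c * f x) ≡ c * ∑ xs f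
  ∑-*ˡ []       c f = sym (zeroʳ c)
  ∑-*ˡ (x ∷ xs) c f = trans (cong₂ _+_ refl (∑-*ˡ xs c f)) (sym (distribˡ c (f x) (∑ xs f)))

  ∑-*ʳ : (xs : List B) (c : A) (f : B → A) → ∑ xs (λ x → f x * c) ≡ ∑ xs f * c
  ∑-*ʳ []       c f = sym (zeroˡ c)
  ∑-*ʳ (x ∷ xs) c f = trans (cong₂ _+_ refl (∑-*ʳ xs c f)) (sym (distribʳ c (f x) (∑ xs f)))

  ∑-swap : (xs : List B) (ys : List C) (f : B → C → A) →
           ∑ xs (λ x → ∑ ys (f x)) ≡ ∑ ys (λ y → ∑ xs (λ x → f x y))
  ∑-swap []       ys f = sym (∑-0 ys)
  ∑-swap (x ∷ xs) ys f =
    trans (cong₂ _+_ refl (∑-swap xs ys f)) (sym (∑-+ ys (f x) (λ y → ∑ xs (λ x → f x y))))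

  ∑-distrib-swap : (xs : List B) (ys : List C) (a : B → A) (b : B → C → A) (c : C → A) →
                   ∑ xs (λ x → a x * ∑ ys (λ y → b x y * c y)) ≡
                   ∑ ys (λ y → ∑ xs (λ x → a x * b x y) * c y)
  ∑-distrib-swap xs ys a b c = begin
    ∑ xs (λ x → a x * ∑ ys (λ y → b x y * c y))
      ≡⟨ ∑-cong xs (λ x → sym (∑-*ˡ ys (a x) _)) ⟩
    ∑ xs (λ x → ∑ ys (λ y → a x * (b x y * c y)))
      ≡⟨ ∑-swap xs ys _ ⟩
    ∑ ys (λ y → ∑ xs (λ x → a x * (b x y * c y)))
      ≡⟨ ∑-cong ys (λ y → ∑-cong xs (λ x → sym (*-assoc (a x) (b x y) (c y)))) ⟩
    ∑ ys (λ y → ∑ xs (λ x → (a x * b x y) * c y))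
      ≡⟨ ∑-cong ys (λ y → ∑-*ʳ xs (c y) _) ⟩
    ∑ ys (λ y → ∑ xs (λ x → a x * b x y) * c y)  ∎
    where open ≡-Reasoning

  ∑-++ : (xs ys : List B) (f : B → A) → ∑ (xs ++ ys) f ≡ ∑ xs f + ∑ ys f
  ∑-++ []       ys f = sym (+-identityˡ _)
  ∑-++ (x ∷ xs) ys f = trans (cong₂ _+_ refl (∑-++ xs ys f)) (sym (+-assoc (f x) (∑ xs f) (∑ ys f)))

  ∑-map : (h : B → C) (xs : List B) (f : C → A) → ∑ (map h xs) f ≡ ∑ xs (f ∘ h)
  ∑-map h xs f = cong (foldr _+_ 0#) (sym (map-∘ xs))

  ∑-concatMap : (h : B → List C) (xs : List B) (f : C → A) →
                ∑ (concatMap h xs) f ≡ ∑ xs (λ x → ∑ (h x) f)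
  ∑-concatMap h []       f = refl
  ∑-concatMap h (x ∷ xs) f =
    trans (∑-++ (h x) (concatMap h xs) f) (cong₂ _+_ refl (∑-concatMap h xs f))

  ∑-allFin-suc : ∀ m (f : Fin (suc m) → A) → ∑ (allFin (suc m)) f ≡ f fz + ∑ (allFin m) (f ∘ fs)
  ∑-allFin-suc m f =
    cong₂ _+_ refl (cong (foldr _+_ 0#) (trans (map-tabulate fs f) (sym (map-tabulate id (f ∘ fs)))))

  ∑-filterᵇ : (p : B → Bool) (xs : List B) (f : B → A) →
              ∑ (filterᵇ p xs) f ≡ ∑ xs (λ x → 𝟙 (p x) * f x)
  ∑-filterᵇ p []       f = refl
  ∑-filterᵇ p (x ∷ xs) f with p x
  ... | true  = cong₂ _+_ (sym (*-identityˡ (f x))) (∑-filterᵇ p xs f)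
  ... | false = trans (∑-filterᵇ p xs f) (sym (trans (cong₂ _+_ (zeroˡ (f x)) refl) (+-identityˡ _)))

module Sumℤ = ListSum ℤP.+-*-isCommutativeSemiring
open Sumℤ using () renaming (∑ to ∑ℤ; 𝟙 to 𝟙ℤ)
open ListSum ℕP.+-*-isCommutativeSemiring

private variable
  B C : Set

+-∑ : (xs : List B) (f : B → ℕ) → + ∑ xs f ≡ ∑ℤ xs (+_ ∘ f)
+-∑ []       f = refl
+-∑ (x ∷ xs) f = trans (ℤP.pos-+ (f x) (∑ xs f)) (cong₂ _+ℤ_ (refl {x = + f x}) (+-∑ xs f))

+-𝟙 : ∀ b → + 𝟙 b ≡ 𝟙ℤ b
+-𝟙 true  = refl
+-𝟙 false = refl

count : (B → Bool) → List B → ℕ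
count p xs = length (filterᵇ p xs)


count≡∑𝟙 : (p : B → Bool) (xs : List B) → count p xs ≡ ∑ xs (𝟙 ∘ p)
count≡∑𝟙 p []       = refl
count≡∑𝟙 p (x ∷ xs) with p x
... | true  = cong suc (count≡∑𝟙 p xs)
... | false = count≡∑𝟙 p xs

+count≡∑𝟙 : (p : B → Bool) (xs : List B) → + count p xs ≡ ∑ℤ xs (𝟙ℤ ∘ p)
+count≡∑𝟙 p xs =
  trans (cong +_ (count≡∑𝟙 p xs)) (trans (+-∑ xs (𝟙 ∘ p)) (Sumℤ.∑-cong xs (+-𝟙 ∘ p)))

count-cong : {p q : B → Bool} (xs : List B) → (∀ x → p x ≡ q x) → count p xs ≡ count q xs
count-cong {p = p} {q = q} xs e =
  trans (count≡∑𝟙 p xs) (trans (∑-cong xs (cong 𝟙 ∘ e)) (sym (count≡∑𝟙 q xs)))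

count≡0 : (p : B → Bool) (xs : List B) → (∀ {x} → x ∈ xs → ¬ T (p x)) → count p xs ≡ 0
count≡0 p xs h = trans (count≡∑𝟙 p xs) (∑-vanishes xs 𝟙≡0)
  where
  𝟙≡0 : ∀ {x} → x ∈ xs → 𝟙 (p x) ≡ 0
  𝟙≡0 {x} x∈xs with p x | h x∈xs
  ... | true  | ¬px = ⊥-elim (¬px _)
  ... | false | _   = refl

count-pos : (p : B → Bool) {xs : List B} {x : B} → x ∈ xs → T (p x) → 0 < count p xs
count-pos p {xs = y ∷ xs} (here refl) py with p y
... | true = s≤s z≤n
count-pos p {xs = y ∷ xs} (there x∈xs) px with p y
... | true  = s≤s z≤n
... | false = count-pos p x∈xs px

count-split : (p q : B → Bool) (xs : List B) →
              count p xs ≡ count (λ x → p x ∧ q x) xs + count (λ x → p x ∧ not (q x)) xs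
count-split p q xs = begin
  count p xs                                                 ≡⟨ count≡∑𝟙 p xs ⟩
  ∑ xs (𝟙 ∘ p)                                               ≡⟨ ∑-cong xs 𝟙-split ⟩
  ∑ xs (λ x → 𝟙 (p x ∧ q x) + 𝟙 (p x ∧ not (q x)))          ≡⟨ ∑-+ xs _ _ ⟩
  ∑ xs (λ x → 𝟙 (p x ∧ q x)) + ∑ xs (λ x → 𝟙 (p x ∧ not (q x)))
    ≡⟨ sym (cong₂ _+_ (count≡∑𝟙 _ xs) (count≡∑𝟙 _ xs)) ⟩
  count (λ x → p x ∧ q x) xs + count (λ x → p x ∧ not (q x)) xs  ∎
  where
  open ≡-Reasoning
  𝟙-split : ∀ x → 𝟙 (p x) ≡ 𝟙 (p x ∧ q x) + 𝟙 (p x ∧ not (q x))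
  𝟙-split x with p x | q x
  ... | true  | true  = refl
  ... | true  | false = refl
  ... | false | _     = refl

count-strict-mono : {p q : B → Bool} (xs : List B) → (∀ {x} → T (p x) → T (q x)) →
                    {y : B} → y ∈ xs → T (q y) → ¬ T (p y) → count p xs < count q xs
count-strict-mono {p = p} {q = q} xs p⇒q {y} y∈xs qy ¬py = begin-strict
  count p xs                                            ≡⟨ count-cong xs q∧p≡p ⟨
  count (λ x → q x ∧ p x) xs                            <⟨ ℕP.m<m+n _ new ⟩
  count (λ x → q x ∧ p x) xs + count (λ x → q x ∧ not (p x)) xs ≡⟨ count-split q p xs ⟨
  count q xs                                            ∎
  where
  open ℕP.≤-Reasoning
  q∧p≡p : ∀ x → (q x ∧ p x) ≡ p x
  q∧p≡p x = T-injective (proj₂ ∘ to T-∧) (λ px → from T-∧ (p⇒q px , px))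
  new : 0 < count (λ x → q x ∧ not (p x)) xs
  new = count-pos _ y∈xs (from T-∧ (qy , T-not⁺ ¬py))

count-bijection : (xs : List B) (ys : List C) (p : B → Bool) (q : C → Bool)
  (R : B → C → Bool) →
  (∀ x → T (p x) → ∑ ys (λ y → 𝟙 (R x y)) ≡ 1) →
  (∀ y → T (q y) → ∑ xs (λ x → 𝟙 (R x y)) ≡ 1) →
  (∀ x y → T (R x y) → T (p x) × T (q y)) →
  count p xs ≡ count q ys
count-bijection xs ys p q R unique-right unique-left R⊆p×q = begin
  count p xs                              ≡⟨ count≡∑𝟙 p xs ⟩
  ∑ xs (𝟙 ∘ p)                            ≡⟨ ∑-cong xs row ⟩
  ∑ xs (λ x → ∑ ys (λ y → 𝟙 (R x y)))     ≡⟨ ∑-swap xs ys _ ⟩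
  ∑ ys (λ y → ∑ xs (λ x → 𝟙 (R x y)))     ≡⟨ ∑-cong ys column ⟩
  ∑ ys (𝟙 ∘ q)                            ≡⟨ count≡∑𝟙 q ys ⟨
  count q ys                              ∎
  where
  open ≡-Reasoning
  row : ∀ x → 𝟙 (p x) ≡ ∑ ys (λ y → 𝟙 (R x y))
  row x with p x in px
  ... | true  = sym (unique-right x (from T-≡ px))
  ... | false = sym (∑-vanishes ys (λ {y} _ → 𝟙≡0 y))
    where
    𝟙≡0 : ∀ y → 𝟙 (R x y) ≡ 0
    𝟙≡0 y with R x y in rxy
    ... | true  = ⊥-elim (subst T px (proj₁ (R⊆p×q x y (from T-≡ rxy))))
    ... | false = refl
  column : ∀ y → ∑ xs (λ x → 𝟙 (R x y)) ≡ 𝟙 (q y)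
  column y with q y in qy
  ... | true  = unique-left y (from T-≡ qy)
  ... | false = ∑-vanishes xs (λ {x} _ → 𝟙≡0 x)
    where
    𝟙≡0 : ∀ x → 𝟙 (R x y) ≡ 0
    𝟙≡0 x with R x y in rxy
    ... | true  = ⊥-elim (subst T qy (proj₂ (R⊆p×q x y (from T-≡ rxy))))
    ... | false = refl

∑-allFin-δ : ∀ {n} (a : Fin n) (f : Fin n → ℕ) → ∑ (allFin n) (λ j → 𝟙 (a ==F j) * f j) ≡ f a
∑-allFin-δ {suc m} fz f = begin
  ∑ (allFin (suc m)) (λ j → 𝟙 (fz ==F j) * f j)  ≡⟨ ∑-allFin-suc m _ ⟩
  f fz + 0 + ∑ (allFin m) (const 0)               ≡⟨ cong₂ _+_ (ℕP.+-identityʳ (f fz)) (∑-0 (allFin m)) ⟩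
  f fz + 0                                        ≡⟨ ℕP.+-identityʳ (f fz) ⟩
  f fz                                            ∎
  where open ≡-Reasoning
∑-allFin-δ {suc m} (fs a) f =
  trans (∑-allFin-suc m (λ j → 𝟙 (fs a ==F j) * f j)) (∑-allFin-δ a (f ∘ fs))

∑-allFin-1 : ∀ n → ∑ (allFin n) (const 1) ≡ n
∑-allFin-1 zero    = refl
∑-allFin-1 (suc n) = trans (∑-allFin-suc n (const 1)) (cong suc (∑-allFin-1 n))

∑-allFin-𝟙==F : ∀ {n} (a : Fin n) → ∑ (allFin n) (λ j → 𝟙 (a ==F j)) ≡ 1
∑-allFin-𝟙==F {n} a =
  trans (∑-cong (allFin n) (λ j → sym (ℕP.*-identityʳ _))) (∑-allFin-δ a (const 1))

module _ {n : ℕ} where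

  countFin≤n : (p : Fin n → Bool) → countFin n p ≤ n
  countFin≤n p = subst (countFin n p ≤_) (length-tabulate id) (length-filter (T? ∘ p) (allFin n))

  count-==F : (x : Fin n) → countFin n (_==F x) ≡ 1
  count-==F x = begin
    countFin n (_==F x)               ≡⟨ count≡∑𝟙 _ (allFin n) ⟩
    ∑ (allFin n) (λ j → 𝟙 (j ==F x))  ≡⟨ ∑-cong (allFin n) (λ j → cong 𝟙 (==F-sym j x)) ⟩
    ∑ (allFin n) (λ j → 𝟙 (x ==F j))  ≡⟨ ∑-allFin-𝟙==F x ⟩
    1                                 ∎
    where open ≡-Reasoning

  count-remove : (p : Fin n → Bool) {x : Fin n} → T (p x) →
                 countFin n p ≡ suc (countFin n (λ u → p u ∧ not (u ==F x)))
  count-remove p {x} px =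
    trans (count-split p (_==F x) (allFin n))
          (cong₂ _+_ (trans (count-cong (allFin n) only-x) (count-==F x)) refl)
    where
    only-x : ∀ u → (p u ∧ (u ==F x)) ≡ (u ==F x)
    only-x u = T-injective (proj₂ ∘ to T-∧) λ u=x →
      from T-∧ (subst (T ∘ p) (sym (==F⇒≡ {x = u} {y = x} u=x)) px , u=x)

  countFin-witness : (p : Fin n → Bool) → 0 < countFin n p → ∃[ x ] T (p x)
  countFin-witness p pos with FinP.any? (λ x → T? (p x))
  ... | yes ∃x = ∃x
  ... | no ¬∃x =
    ⊥-elim (ℕP.<-irrefl (sym (count≡0 p (allFin n) (λ {x} _ px → ¬∃x (x , px)))) pos)

  count≡1-unique : (p : Fin n → Bool) → countFin n p ≡ 1 →
                   {a b : Fin n} → T (p a) → T (p b) → a ≡ b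
  count≡1-unique p one {a} {b} pa pb with a FinP.≟ b
  ... | yes a≡b = a≡b
  ... | no  a≢b = ⊥-elim (ℕP.<-irrefl (sym rest≡0) (count-pos _ (∈-allFin b) b-in-rest))
    where
    rest≡0 : countFin n (λ u → p u ∧ not (u ==F a)) ≡ 0
    rest≡0 = ℕP.suc-injective (trans (sym (count-remove p pa)) one)
    b-in-rest : T (p b ∧ not (b ==F a))
    b-in-rest = from T-∧ (pb , T-not⁺ (λ b=a → a≢b (sym (==F⇒≡ b=a))))

allF-suc : ∀ m (p : Fin (suc m) → Bool) → allF (suc m) p ≡ (p fz ∧ allF m (p ∘ fs))
allF-suc m p =
  cong (p fz ∧_) (cong (foldr _∧_ true) (trans (map-tabulate fs p) (sym (map-tabulate id (p ∘ fs)))))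

pointwiseᵇ : ∀ {n} → (B → B → Bool) → (Fin n → B) → (Fin n → B) → Bool
pointwiseᵇ {n = n} E f h = allF n (λ i → E (f i) (h i))

∑-allFuns-δ : (xs : List B) (E : B → B → Bool) → (∀ b → ∑ xs (λ x → 𝟙 (E x b)) ≡ 1) →
              ∀ n (h : Fin n → B) → ∑ (allFuns n xs) (λ f → 𝟙 (pointwiseᵇ E f h)) ≡ 1
∑-allFuns-δ xs E δ zero    h = refl
∑-allFuns-δ xs E δ (suc n) h = begin
  ∑ (allFuns (suc n) xs) (λ f → 𝟙 (pointwiseᵇ E f h))
    ≡⟨ ∑-concatMap _ xs _ ⟩
  ∑ xs (λ a → ∑ (map (cons a) (allFuns n xs)) (λ f → 𝟙 (pointwiseᵇ E f h)))
    ≡⟨ ∑-cong xs (λ a → ∑-map (cons a) (allFuns n xs) _) ⟩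
  ∑ xs (λ a → ∑ (allFuns n xs) (λ f → 𝟙 (pointwiseᵇ E (cons a f) h)))
    ≡⟨ ∑-cong xs (λ a → ∑-cong (allFuns n xs) (λ f →
         trans (cong 𝟙 (allF-suc n _)) (𝟙-∧ (E a (h fz)) (pointwiseᵇ E f (h ∘ fs))))) ⟩
  ∑ xs (λ a → ∑ (allFuns n xs) (λ f → 𝟙 (E a (h fz)) * 𝟙 (pointwiseᵇ E f (h ∘ fs))))
    ≡⟨ ∑-cong xs (λ a → ∑-*ˡ (allFuns n xs) (𝟙 (E a (h fz))) _) ⟩
  ∑ xs (λ a → 𝟙 (E a (h fz)) * ∑ (allFuns n xs) (λ f → 𝟙 (pointwiseᵇ E f (h ∘ fs))))
    ≡⟨ ∑-cong xs (λ a →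
         trans (cong (𝟙 (E a (h fz)) *_) (∑-allFuns-δ xs E δ n (h ∘ fs))) (ℕP.*-identityʳ _)) ⟩
  ∑ xs (λ a → 𝟙 (E a (h fz)))
    ≡⟨ δ (h fz) ⟩
  1 ∎
  where open ≡-Reasoning

module _ {n N : ℕ} where

  _≗ᵇ_ : (Fin n → Fin N) → (Fin n → Fin N) → Bool
  _≗ᵇ_ = pointwiseᵇ _==F_

  ≗ᵇ⇒≗ : {f h : Fin n → Fin N} → T (f ≗ᵇ h) → ∀ i → f i ≡ h i
  ≗ᵇ⇒≗ f≗h i = ==F⇒≡ (allF⁻ f≗h i)

  ≗⇒≗ᵇ : {f h : Fin n → Fin N} → (∀ i → f i ≡ h i) → T (f ≗ᵇ h)
  ≗⇒≗ᵇ f≗h = allF⁺ (≡⇒==F ∘ f≗h)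

  ∑-allFuns-≗ᵇ : (h : Fin n → Fin N) → ∑ (allFuns n (allFin N)) (λ f → 𝟙 (f ≗ᵇ h)) ≡ 1
  ∑-allFuns-≗ᵇ =
    ∑-allFuns-δ (allFin N) _==F_ (λ b → trans (sym (count≡∑𝟙 _ (allFin N))) (count-==F b)) n

_==ᴮ_ : Bool → Bool → Bool
a ==ᴮ b = ⌊ a Boolᴾ.≟ b ⌋

module _ {n : ℕ} where

  _≐ᵇ_ : Rel n → Rel n → Bool
  _≐ᵇ_ = pointwiseᵇ (pointwiseᵇ _==ᴮ_)

  ≐ᵇ⇒≐ : {K K′ : Rel n} → T (K ≐ᵇ K′) → ∀ x y → K x y ≡ K′ x y
  ≐ᵇ⇒≐ K≐K′ x y = toWitness (allF⁻ (allF⁻ K≐K′ x) y)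

  ≐⇒≐ᵇ : {K K′ : Rel n} → (∀ x y → K x y ≡ K′ x y) → T (K ≐ᵇ K′)
  ≐⇒≐ᵇ K≐K′ = allF⁺ (λ x → allF⁺ (λ y → fromWitness (K≐K′ x y)))

  ∑-allRels-≐ᵇ : (K : Rel n) → ∑ (allRels n) (λ K′ → 𝟙 (K′ ≐ᵇ K)) ≡ 1
  ∑-allRels-≐ᵇ = ∑-allFuns-δ _ _ (∑-allFuns-δ _ _==ᴮ_ δ n) n
    where
    δ : ∀ b → ∑ (true ∷ false ∷ []) (λ a → 𝟙 (a ==ᴮ b)) ≡ 1
    δ true  = refl
    δ false = refl

data DropZeros : List ℕ → List ℕ → Set where
  []   : DropZeros [] []
  keep : ∀ {x α β} → DropZeros α β → DropZeros (x ∷ α) (x ∷ β)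
  drop : ∀ {α β} → DropZeros α β → DropZeros (0 ∷ α) β

stripZeros-drops : ∀ α → DropZeros α (stripZeros α)
stripZeros-drops []          = []
stripZeros-drops (zero ∷ α)  = drop (stripZeros-drops α)
stripZeros-drops (suc k ∷ α) = keep (stripZeros-drops α)

embed : ∀ {α β} → DropZeros α β → Fin (length β) → Fin (length α)
embed (keep d) fz     = fz
embed (keep d) (fs i) = fs (embed d i)
embed (drop d) i      = fs (embed d i)

embed-injective : ∀ {α β} (d : DropZeros α β) {i j} → embed d i ≡ embed d j → i ≡ j
embed-injective (keep d) {fz}   {fz}   _ = refl
embed-injective (keep d) {fs i} {fs j} e = cong fs (embed-injective d (FinP.suc-injective e))
embed-injective (drop d)               e = embed-injective d (FinP.suc-injective e)

lookup-embed : ∀ {α β} (d : DropZeros α β) i → lookup α (embed d i) ≡ lookup β i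
lookup-embed (keep d) fz     = refl
lookup-embed (keep d) (fs i) = lookup-embed d i
lookup-embed (drop d) i      = lookup-embed d i

embed-or-dropped : ∀ {α β} (d : DropZeros α β) (j : Fin (length α)) →
                   (∃[ i ] embed d i ≡ j) ⊎ (lookup α j ≡ 0 × ∀ i → embed d i ≢ j)
embed-or-dropped (keep d) fz     = inj₁ (fz , refl)
embed-or-dropped (keep d) (fs j) with embed-or-dropped d j
... | inj₁ (i , refl)   = inj₁ (fs i , refl)
... | inj₂ (is-zero , ∉d) = inj₂ (is-zero , λ { fz () ; (fs i) e → ∉d i (FinP.suc-injective e) })
embed-or-dropped (drop d) fz     = inj₂ (refl , λ i ())
embed-or-dropped (drop d) (fs j) with embed-or-dropped d j
... | inj₁ (i , refl)   = inj₁ (i , refl)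
... | inj₂ (is-zero , ∉d) = inj₂ (is-zero , λ i e → ∉d i (FinP.suc-injective e))

==F-embed : ∀ {α β} (d : DropZeros α β) i j → (embed d i ==F embed d j) ≡ (i ==F j)
==F-embed d i j =
  T-injective (≡⇒==F ∘ embed-injective d ∘ ==F⇒≡) (≡⇒==F ∘ cong (embed d) ∘ ==F⇒≡)

stripZeros-positive : ∀ α → All (0 <_) (stripZeros α)
stripZeros-positive []          = []
stripZeros-positive (zero ∷ α)  = stripZeros-positive α
stripZeros-positive (suc k ∷ α) = s≤s z≤n ∷ stripZeros-positive α

sum-stripZeros : ∀ α → sumℕ (stripZeros α) ≡ sumℕ α
sum-stripZeros []          = refl
sum-stripZeros (zero ∷ α)  = sum-stripZeros α
sum-stripZeros (suc k ∷ α) = cong₂ _+_ refl (sum-stripZeros α)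

==L⇒≡ : ∀ a b → T (a ==L b) → a ≡ b
==L⇒≡ []      []      _ = refl
==L⇒≡ (x ∷ a) (y ∷ b) h = let x≡y , a≡b = to T-∧ h in
  cong₂ _∷_ (ℕP.≡ᵇ⇒≡ x y x≡y) (==L⇒≡ a b a≡b)

-- Compositions

StartsPositive : List ℕ → Set
StartsPositive a = ∃[ k ] ∃[ as ] a ≡ suc k ∷ as

compositions-startsPositive : ∀ m → All StartsPositive (compositions (suc m))
compositions-startsPositive zero    = (0 , [] , refl) ∷ []
compositions-startsPositive (suc m) =
  AllP.++⁺ (AllP.map⁺ (All.universal (λ a → 0 , a , refl) _))
           (AllP.map⁺ (All.map incHead-startsPositive (compositions-startsPositive m)))
  where
  incHead-startsPositive : ∀ {a} → StartsPositive a → StartsPositive (incHead a)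
  incHead-startsPositive (k , as , refl) = suc k , as , refl

∑-compositions-suc : ∀ m (f : List ℕ → ℕ) → ∑ (compositions (suc (suc m))) f ≡
                     ∑ (compositions (suc m)) (f ∘ (1 ∷_)) + ∑ (compositions (suc m)) (f ∘ incHead)
∑-compositions-suc m f =
  trans (∑-++ (map (1 ∷_) cs) (map incHead cs) f) (cong₂ _+_ (∑-map _ cs f) (∑-map _ cs f))
  where cs = compositions (suc m)

∑-compositions-δ : ∀ γ → All (0 <_) γ → ∑ (compositions (sumℕ γ)) (λ a → 𝟙 (γ ==L a)) ≡ 1
∑-compositions-δ []                _           = refl
∑-compositions-δ (zero ∷ γ)        (() ∷ _)
∑-compositions-δ (1 ∷ [])          _           = refl
∑-compositions-δ (1 ∷ zero ∷ γ)    (_ ∷ () ∷ _)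
∑-compositions-δ (1 ∷ suc j ∷ γ)   (_ ∷ γ-pos) =
  trans (∑-compositions-suc (j + sumℕ γ) (λ a → 𝟙 ((1 ∷ suc j ∷ γ) ==L a)))
        (cong₂ _+_ (∑-compositions-δ (suc j ∷ γ) γ-pos) (∑-vanishes _ head-differs))
  where
  head-differs : ∀ {a} → a ∈ compositions (suc j + sumℕ γ) →
                 𝟙 ((1 ∷ suc j ∷ γ) ==L incHead a) ≡ 0
  head-differs a∈ with All.lookup (compositions-startsPositive (j + sumℕ γ)) a∈
  ... | _ , _ , refl = refl
∑-compositions-δ (suc (suc k) ∷ γ) (_ ∷ γ-pos) =
  trans (∑-compositions-suc (k + sumℕ γ) (λ a → 𝟙 ((suc (suc k) ∷ γ) ==L a)))
        (trans (cong₂ _+_ (∑-0 (compositions (suc k + sumℕ γ))) (∑-cong∈ _ head-decrements))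
               (∑-compositions-δ (suc k ∷ γ) (s≤s z≤n ∷ γ-pos)))
  where
  head-decrements : ∀ {a} → a ∈ compositions (suc k + sumℕ γ) →
                    𝟙 ((suc (suc k) ∷ γ) ==L incHead a) ≡ 𝟙 ((suc k ∷ γ) ==L a)
  head-decrements a∈ with All.lookup (compositions-startsPositive (k + sumℕ γ)) a∈
  ... | _ , _ , refl = refl

-- The coefficients of Ψ(g)

module _ {n : ℕ} where

  fibreSize : ∀ {N} → (Fin n → Fin N) → Fin N → ℕ
  fibreSize f i = countFin n (λ v → f v ==F i)

  hasContent : (α : List ℕ) → (Fin n → Fin (length α)) → Bool
  hasContent α f = allF (length α) (λ i → fibreSize f i ≡ᵇ lookup α i)

  hasContent⁻ : ∀ {α f} → T (hasContent α f) → ∀ i → fibreSize f i ≡ lookup α i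
  hasContent⁻ h i = ℕP.≡ᵇ⇒≡ _ _ (allF⁻ h i)

  hasContent⁺ : ∀ {α f} → (∀ i → fibreSize f i ≡ lookup α i) → T (hasContent α f)
  hasContent⁺ h = allF⁺ (λ i → ℕP.≡⇒≡ᵇ _ _ (h i))

  hasContent-cong : ∀ α {f f′ : Fin n → Fin (length α)} → (∀ v → f v ≡ f′ v) →
                    hasContent α f ≡ hasContent α f′
  hasContent-cong α e =
    allF-cong λ i → cong (_≡ᵇ lookup α i) (count-cong (allFin n) (λ v → cong (_==F i) (e v)))

  fibreSize-embed : ∀ {α β} (d : DropZeros α β) (f : Fin n → Fin (length β)) i →
                    fibreSize (embed d ∘ f) (embed d i) ≡ fibreSize f i
  fibreSize-embed d f i = count-cong (allFin n) (λ v → ==F-embed d (f v) i)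

  hasContent-embed : ∀ {α β} (d : DropZeros α β) (f : Fin n → Fin (length β)) →
                     hasContent α (embed d ∘ f) ≡ hasContent β f
  hasContent-embed {α} {β} d f = T-injective
    (λ h → hasContent⁺ {β} {f} λ i → begin
      fibreSize f i                     ≡⟨ fibreSize-embed d f i ⟨
      fibreSize (embed d ∘ f) (embed d i) ≡⟨ hasContent⁻ {α} {embed d ∘ f} h (embed d i) ⟩
      lookup α (embed d i)              ≡⟨ lookup-embed d i ⟩
      lookup β i                        ∎)
    (λ h → hasContent⁺ {α} {embed d ∘ f} λ j → case-on (embed-or-dropped d j) h)
    where
    open ≡-Reasoning
    case-on : ∀ {j} → (∃[ i ] embed d i ≡ j) ⊎ (lookup α j ≡ 0 × ∀ i → embed d i ≢ j) →
              T (hasContent β f) → fibreSize (embed d ∘ f) j ≡ lookup α j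
    case-on (inj₁ (i , refl)) h =
      trans (fibreSize-embed d f i) (trans (hasContent⁻ {β} {f} h i) (sym (lookup-embed d i)))
    case-on (inj₂ (is-zero , ∉d)) _ =
      trans (count≡0 _ (allFin n) (λ {v} _ e → ∉d (f v) (==F⇒≡ {x = embed d (f v)} e))) (sym is-zero)

  ∑-fibreSize : ∀ {N} (f : Fin n → Fin N) → ∑ (allFin N) (fibreSize f) ≡ n
  ∑-fibreSize {N} f = begin
    ∑ (allFin N) (fibreSize f)
      ≡⟨ ∑-cong (allFin N) (λ _ → count≡∑𝟙 _ (allFin n)) ⟩
    ∑ (allFin N) (λ j → ∑ (allFin n) (λ v → 𝟙 (f v ==F j)))
      ≡⟨ ∑-swap (allFin n) (allFin N) _ ⟨
    ∑ (allFin n) (λ v → ∑ (allFin N) (λ j → 𝟙 (f v ==F j)))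
      ≡⟨ ∑-cong (allFin n) (∑-allFin-𝟙==F ∘ f) ⟩
    ∑ (allFin n) (const 1)
      ≡⟨ ∑-allFin-1 n ⟩
    n ∎
    where open ≡-Reasoning

  hasContent⇒sum≡n : ∀ {α f} → T (hasContent α f) → sumℕ α ≡ n
  hasContent⇒sum≡n {α} {f} h = begin
    sumℕ α                               ≡⟨ ∑-lookup α ⟨
    ∑ (allFin (length α)) (lookup α)     ≡⟨ ∑-cong (allFin (length α)) (hasContent⁻ {α} {f} h) ⟨
    ∑ (allFin (length α)) (fibreSize f)  ≡⟨ ∑-fibreSize f ⟩
    n                                    ∎
    where
    open ≡-Reasoning
    ∑-lookup : ∀ β → ∑ (allFin (length β)) (lookup β) ≡ sumℕ β
    ∑-lookup []      = refl
    ∑-lookup (x ∷ β) =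
      trans (∑-allFin-suc (length β) (lookup (x ∷ β))) (cong₂ _+_ refl (∑-lookup β))

module _ {n : ℕ} (g : SimpleGraph n) where

  matchingColouring : ∀ {N} → (Fin n → Fin N) → Bool
  matchingColouring f = allF n (λ v → countFin n (λ u → (f u ==F f v) ∧ adj g v u) ≡ᵇ 1)

  okOrdered-cong : ∀ α {f f′ : Fin n → Fin (length α)} → (∀ v → f v ≡ f′ v) →
                   okOrdered g α f ≡ okOrdered g α f′
  okOrdered-cong α e = cong₂ _∧_ (hasContent-cong α e) (allF-cong λ v → cong (_≡ᵇ 1)
    (count-cong (allFin n) (λ u → cong₂ (λ a b → (a ==F b) ∧ adj g v u) (e u) (e v))))

  okOrdered-embed : ∀ {α β} (d : DropZeros α β) (f : Fin n → Fin (length β)) →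
                    okOrdered g α (embed d ∘ f) ≡ okOrdered g β f
  okOrdered-embed d f = cong₂ _∧_ (hasContent-embed d f) (allF-cong λ v → cong (_≡ᵇ 1)
    (count-cong (allFin n) (λ u → cong (_∧ adj g v u) (==F-embed d (f u) (f v)))))

  c-dropZeros : ∀ {α β} → DropZeros α β → c g α ≡ c g β
  c-dropZeros {α} {β} d =
    count-bijection (allFuns n (allFin (length α))) (allFuns n (allFin (length β)))
                    (okOrdered g α) (okOrdered g β) R unique-right unique-left R⊆ok×ok
    where
    R : (Fin n → Fin (length α)) → (Fin n → Fin (length β)) → Bool
    R f f′ = okOrdered g α f ∧ (f ≗ᵇ (embed d ∘ f′))

    transfer : ∀ f f′ → (∀ v → f v ≡ embed d (f′ v)) → okOrdered g α f ≡ okOrdered g β f′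
    transfer f f′ e = trans (okOrdered-cong α e) (okOrdered-embed d f′)

    unique-right : ∀ f → T (okOrdered g α f) →
                   ∑ (allFuns n (allFin (length β))) (λ f′ → 𝟙 (R f f′)) ≡ 1
    unique-right f ok =
      trans (∑-cong (allFuns n (allFin (length β))) (cong 𝟙 ∘ R≡)) (∑-allFuns-≗ᵇ (proj₁ ∘ preimage))
      where
      preimage : ∀ v → ∃[ i ] embed d i ≡ f v
      preimage v with embed-or-dropped d (f v)
      ... | inj₁ p             = p
      ... | inj₂ (is-zero , _) =
        ⊥-elim (ℕP.<-irrefl (sym empty) (count-pos _ (∈-allFin v) (≡⇒==F {x = f v} refl)))
        where
        empty : fibreSize f (f v) ≡ 0
        empty = trans (hasContent⁻ {α = α} {f = f} (proj₁ (to T-∧ ok)) (f v)) is-zero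
      R≡ : ∀ f′ → R f f′ ≡ (f′ ≗ᵇ (proj₁ ∘ preimage))
      R≡ f′ = T-injective
        (λ r → ≗⇒≗ᵇ λ v → embed-injective d
          (trans (sym (≗ᵇ⇒≗ {f = f} (proj₂ (to T-∧ r)) v)) (sym (proj₂ (preimage v)))))
        (λ e → from T-∧ (ok , ≗⇒≗ᵇ λ v →
          trans (sym (proj₂ (preimage v))) (cong (embed d) (sym (≗ᵇ⇒≗ {f = f′} e v)))))

    unique-left : ∀ f′ → T (okOrdered g β f′) →
                  ∑ (allFuns n (allFin (length α))) (λ f → 𝟙 (R f f′)) ≡ 1
    unique-left f′ ok′ =
      trans (∑-cong (allFuns n (allFin (length α))) (cong 𝟙 ∘ R≡)) (∑-allFuns-≗ᵇ (embed d ∘ f′))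
      where
      R≡ : ∀ f → R f f′ ≡ (f ≗ᵇ (embed d ∘ f′))
      R≡ f = T-injective (proj₂ ∘ to T-∧) λ e →
        from T-∧ (subst T (sym (transfer f f′ (≗ᵇ⇒≗ {f = f} e))) ok′ , e)

    R⊆ok×ok : ∀ f f′ → T (R f f′) → T (okOrdered g α f) × T (okOrdered g β f′)
    R⊆ok×ok f f′ r = let ok , e = to T-∧ r in ok , subst T (transfer f f′ (≗ᵇ⇒≗ {f = f} e)) ok

  c-stripZeros : ∀ α → c g (stripZeros α) ≡ c g α
  c-stripZeros α = sym (c-dropZeros (stripZeros-drops α))

  c≡0 : ∀ α → sumℕ α ≢ n → c g α ≡ 0
  c≡0 α sum≢n = count≡0 (okOrdered g α) (allFuns n (allFin (length α))) λ {f} _ ok →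
    sum≢n (hasContent⇒sum≡n {α = α} {f = f} (proj₁ (to T-∧ ok)))

  coeffΨ≡c : ∀ α → coeffΨ g α ≡ + c g α
  coeffΨ≡c α = begin
    ∑ℤ (compositions n) (λ a → + c g a *ℤ 𝟙ℤ (s ==L a))
      ≡⟨ Sumℤ.∑-cong (compositions n) (λ a →
           trans (cong (+ c g a *ℤ_) (sym (+-𝟙 (s ==L a)))) (sym (ℤP.pos-* (c g a) _))) ⟩
    ∑ℤ (compositions n) (λ a → + (c g a * 𝟙 (s ==L a)))
      ≡⟨ +-∑ (compositions n) _ ⟨
    + ∑ (compositions n) (λ a → c g a * 𝟙 (s ==L a))
      ≡⟨ cong +_ (∑-cong (compositions n) only-s) ⟩
    + ∑ (compositions n) (λ a → c g s * 𝟙 (s ==L a))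
      ≡⟨ cong +_ (∑-*ˡ (compositions n) (c g s) _) ⟩
    + (c g s * ∑ (compositions n) (λ a → 𝟙 (s ==L a)))
      ≡⟨ cong +_ (c-stripped-occurrences (sumℕ α ℕP.≟ n)) ⟩
    + c g α ∎
    where
    open ≡-Reasoning
    s = stripZeros α
    only-s : ∀ a → c g a * 𝟙 (s ==L a) ≡ c g s * 𝟙 (s ==L a)
    only-s a with s ==L a in s=a
    ... | true  = cong (λ b → c g b * 1) (sym (==L⇒≡ s a (from T-≡ s=a)))
    ... | false = trans (ℕP.*-zeroʳ (c g a)) (sym (ℕP.*-zeroʳ (c g s)))
    c-stripped-occurrences : Dec (sumℕ α ≡ n) →
                             c g s * ∑ (compositions n) (λ a → 𝟙 (s ==L a)) ≡ c g α
    c-stripped-occurrences (yes sum≡n) = begin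
      c g s * ∑ (compositions n) (λ a → 𝟙 (s ==L a))
        ≡⟨ cong (λ m → c g s * ∑ (compositions m) (λ a → 𝟙 (s ==L a)))
                (trans (sym sum≡n) (sym (sum-stripZeros α))) ⟩
      c g s * ∑ (compositions (sumℕ s)) (λ a → 𝟙 (s ==L a))
        ≡⟨ cong (c g s *_) (∑-compositions-δ s (stripZeros-positive α)) ⟩
      c g s * 1
        ≡⟨ trans (ℕP.*-identityʳ (c g s)) (c-stripZeros α) ⟩
      c g α ∎
    c-stripped-occurrences (no sum≢n) =
      trans (cong (_* ∑ (compositions n) (λ a → 𝟙 (s ==L a))) (trans (c-stripZeros α) (c≡0 α sum≢n)))
            (sym (c≡0 α sum≢n))

module _ {n : ℕ} where

  ⟦_⟧ : Rel n → Fin n → Fin n → Set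
  ⟦ K ⟧ x y = T (K x y)

  private
    reflexiveᵇ symmetricᵇ transitiveᵇ : Rel n → Bool
    reflexiveᵇ  K = allF n (λ x → K x x)
    symmetricᵇ  K = allF n (λ x → allF n (λ y → K x y ⇒ᵇ K y x))
    transitiveᵇ K = allF n (λ x → allF n (λ y → allF n (λ z → (K x y ∧ K y z) ⇒ᵇ K x z)))

  isEquiv⁻ : (K : Rel n) → T (isEquiv K) → IsEquivalence ⟦ K ⟧
  isEquiv⁻ K h = record
    { refl  = λ {x} → allF⁻ {p = λ x → K x x} reflexive x
    ; sym   = λ {x} {y} → ⇒ᵇ⁻ (allF⁻ {p = λ y → K x y ⇒ᵇ K y x} (allF⁻ symmetric x) y)
    ; trans = λ {x} {y} {z} p q →
        ⇒ᵇ⁻ (allF⁻ {p = λ z → (K x y ∧ K y z) ⇒ᵇ K x z} (allF⁻ (allF⁻ transitive x) y) z)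
            (from T-∧ (p , q))
    }
    where
    reflexive : T (reflexiveᵇ K)
    reflexive = proj₁ (to (T-∧ {reflexiveᵇ K}) h)
    symmetric : T (symmetricᵇ K)
    symmetric = proj₁ (to (T-∧ {symmetricᵇ K}) (proj₂ (to (T-∧ {reflexiveᵇ K}) h)))
    transitive : T (transitiveᵇ K)
    transitive = proj₂ (to (T-∧ {symmetricᵇ K}) (proj₂ (to (T-∧ {reflexiveᵇ K}) h)))

  isEquiv⁺ : (K : Rel n) → IsEquivalence ⟦ K ⟧ → T (isEquiv K)
  isEquiv⁺ K eq = from (T-∧ {reflexiveᵇ K} {symmetricᵇ K ∧ transitiveᵇ K})
    ( allF⁺ {p = λ x → K x x} (λ _ → refl′)
    , from (T-∧ {symmetricᵇ K} {transitiveᵇ K})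
      ( allF⁺ {p = λ x → allF n (λ y → K x y ⇒ᵇ K y x)}
              (λ x → allF⁺ {p = λ y → K x y ⇒ᵇ K y x} (λ _ → ⇒ᵇ⁺ sym′))
      , allF⁺ {p = λ x → allF n (λ y → allF n (λ z → (K x y ∧ K y z) ⇒ᵇ K x z))}
              (λ x → allF⁺ {p = λ y → allF n (λ z → (K x y ∧ K y z) ⇒ᵇ K x z)}
              (λ y → allF⁺ {p = λ z → (K x y ∧ K y z) ⇒ᵇ K x z}
              (λ z → ⇒ᵇ⁺ (λ p → let xy , yz = to (T-∧ {K x y}) p in trans′ xy yz))))))
    where open IsEquivalence eq renaming (refl to refl′; sym to sym′; trans to trans′)

  ⊑⁻ : (K′ K : Rel n) → T (K′ ⊑ K) → ⟦ K′ ⟧ ⇒ ⟦ K ⟧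
  ⊑⁻ K′ K h {x} {y} =
    ⇒ᵇ⁻ (allF⁻ {p = λ y → K′ x y ⇒ᵇ K x y}
          (allF⁻ {p = λ x → allF n (λ y → K′ x y ⇒ᵇ K x y)} h x) y)

  ⊑⁺ : (K′ K : Rel n) → ⟦ K′ ⟧ ⇒ ⟦ K ⟧ → T (K′ ⊑ K)
  ⊑⁺ K′ K h = allF⁺ {p = λ x → allF n (λ y → K′ x y ⇒ᵇ K x y)}
                    (λ x → allF⁺ {p = λ y → K′ x y ⇒ᵇ K x y} (λ y → ⇒ᵇ⁺ h))

  ker : ∀ {N} → (Fin n → Fin N) → Rel n
  ker f x y = f x ==F f y

  ker-isEquivalence : ∀ {N} (f : Fin n → Fin N) → IsEquivalence ⟦ ker f ⟧
  ker-isEquivalence f = record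
    { refl  = λ {x} → ≡⇒==F {x = f x} refl
    ; sym   = λ {x} {y} p → ≡⇒==F (sym (==F⇒≡ {x = f x} p))
    ; trans = λ {x} {y} {z} p q → ≡⇒==F (trans (==F⇒≡ {x = f x} p) (==F⇒≡ {x = f y} q))
    }

  ⊑ker⁻ : ∀ {N} (K : Rel n) (f : Fin n → Fin N) → T (K ⊑ ker f) →
          ∀ {x y} → ⟦ K ⟧ x y → f x ≡ f y
  ⊑ker⁻ K f h {x} K-xy = ==F⇒≡ {x = f x} (⊑⁻ K (ker f) h K-xy)

-- The coefficients of p_λ(K)

powerSumColouring : (μ α : List ℕ) → (Fin (length μ) → Fin (length α)) → Bool
powerSumColouring μ α h = allF (length α) λ i →
  sumℕ (map (lookup μ) (filterᵇ (λ j → h j ==F i) (allFin (length μ)))) ≡ᵇ lookup α i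

coeffP≡count : ∀ μ α →
               coeffP μ α ≡ + count (powerSumColouring μ α) (allFuns (length μ) (allFin (length α)))
coeffP≡count μ α = refl

module Blocks {n : ℕ} (K : Rel n) (K-equiv : IsEquivalence ⟦ K ⟧) where

  open IsEquivalence K-equiv renaming (refl to K-refl; sym to K-sym; trans to K-trans)

  isRep : Fin n → Bool
  isRep x = not (anyF n (λ y → (toℕ y <ᵇ toℕ x) ∧ K x y))

  reps : List (Fin n)
  reps = filterᵇ isRep (allFin n)

  size : Fin n → ℕ
  size x = countFin n (K x)

  repAt : (rs : List (Fin n)) → Fin (length (map size rs)) → Fin n
  repAt (x ∷ rs) fz     = x
  repAt (x ∷ rs) (fs j) = repAt rs j

  lookup-map-size : ∀ rs j → lookup (map size rs) j ≡ size (repAt rs j)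
  lookup-map-size (x ∷ rs) fz     = refl
  lookup-map-size (x ∷ rs) (fs j) = lookup-map-size rs j

  repAt-∈ : ∀ rs j → repAt rs j ∈ rs
  repAt-∈ (x ∷ rs) fz     = here refl
  repAt-∈ (x ∷ rs) (fs j) = there (repAt-∈ rs j)

  repAt-injective : ∀ {rs} → Unique rs → ∀ i j → repAt rs i ≡ repAt rs j → i ≡ j
  repAt-injective {x ∷ rs} _            fz     fz     _ = refl
  repAt-injective {x ∷ rs} (x∉rs ∷ _)   fz     (fs j) e = ⊥-elim (All.lookup x∉rs (repAt-∈ rs j) e)
  repAt-injective {x ∷ rs} (x∉rs ∷ _)   (fs i) fz     e = ⊥-elim (All.lookup x∉rs (repAt-∈ rs i) (sym e))
  repAt-injective {x ∷ rs} (_ ∷ unique) (fs i) (fs j) e = cong fs (repAt-injective unique i j e)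

  indexOf : ∀ {P : Fin n → Set} {rs} → Any P rs → Fin (length (map size rs))
  indexOf (here _)  = fz
  indexOf (there p) = fs (indexOf p)

  repAt-indexOf : ∀ {P : Fin n → Set} {rs} (p : Any P rs) → P (repAt rs (indexOf p))
  repAt-indexOf (here px) = px
  repAt-indexOf (there p) = repAt-indexOf p

  isRep-unique : ∀ {a b} → T (isRep a) → T (isRep b) → ⟦ K ⟧ a b → a ≡ b
  isRep-unique {a} {b} rep-a rep-b K-ab with ℕP.<-cmp (toℕ a) (toℕ b)
  ... | tri< a<b _ _ = ⊥-elim (T-not⁻ rep-b (anyF⁺ a (from T-∧ (ℕP.<⇒<ᵇ a<b , K-sym K-ab))))
  ... | tri≈ _ a≡b _ = FinP.toℕ-injective a≡b
  ... | tri> _ _ b<a = ⊥-elim (T-not⁻ rep-a (anyF⁺ b (from T-∧ (ℕP.<⇒<ᵇ b<a , K-ab))))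

  has-rep : ∀ k v → toℕ v < k → Any (⟦ K ⟧ v) reps
  has-rep (suc k) v v<k with isRep v in rep-v
  ... | true  = Any.map (λ { refl → K-refl }) (∈-filter⁺ (T? ∘ isRep) (∈-allFin v) (from T-≡ rep-v))
  ... | false with anyF⁻ {p = λ y → (toℕ y <ᵇ toℕ v) ∧ K v y} (not≡false⇒T rep-v)
  ...   | y , y<v∧K-vy with to (T-∧ {toℕ y <ᵇ toℕ v}) y<v∧K-vy
  ...     | y<v , K-vy =
    Any.map (K-trans K-vy) (has-rep k y (ℕP.<-≤-trans (ℕP.<ᵇ⇒< _ _ y<v) (ℕP.≤-pred v<k)))

  m : ℕ
  m = length (blockSizes K)

  rep : Fin m → Fin n
  rep = repAt reps

  block : Fin n → Fin m
  block v = indexOf (has-rep (suc (toℕ v)) v ℕP.≤-refl)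

  K-rep-block : ∀ v → ⟦ K ⟧ v (rep (block v))
  K-rep-block v = repAt-indexOf (has-rep (suc (toℕ v)) v ℕP.≤-refl)

  rep-isRep : ∀ j → T (isRep (rep j))
  rep-isRep j = All.lookup (AllP.all-filter (T? ∘ isRep) (allFin n)) (repAt-∈ reps j)

  block≡⇔K : ∀ v j → block v ≡ j ⇔ ⟦ K ⟧ (rep j) v
  block≡⇔K v j = mk⇔
    (λ { refl → K-sym (K-rep-block v) })
    (λ K-jv → repAt-injective (UniqueP.filter⁺ (T? ∘ isRep) (UniqueP.allFin⁺ n)) (block v) j
                (sym (isRep-unique (rep-isRep j) (rep-isRep (block v)) (K-trans K-jv (K-rep-block v)))))

  block-rep : ∀ j → block (rep j) ≡ j
  block-rep j = from (block≡⇔K (rep j) j) K-refl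

  K⇒block≡ : ∀ {x y} → ⟦ K ⟧ x y → block x ≡ block y
  K⇒block≡ {x} {y} K-xy =
    sym (from (block≡⇔K y (block x)) (K-trans (to (block≡⇔K x (block x)) refl) K-xy))

  blockSize≡fibreSize : ∀ j → lookup (blockSizes K) j ≡ fibreSize block j
  blockSize≡fibreSize j = trans (lookup-map-size reps j)
    (count-cong (allFin n) λ v →
      T-injective (≡⇒==F ∘ from (block≡⇔K v j)) (to (block≡⇔K v j) ∘ ==F⇒≡))

  module _ (α : List ℕ) where

    private
      N : ℕ
      N = length α
      Hs : List (Fin m → Fin N)
      Hs = allFuns m (allFin N)
      Fs : List (Fin n → Fin N)
      Fs = allFuns n (allFin N)

    powerSumColouring≡hasContent : ∀ h →
                                   powerSumColouring (blockSizes K) α h ≡ hasContent α (h ∘ block)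
    powerSumColouring≡hasContent h = allF-cong λ i → cong (_≡ᵇ lookup α i) (weight≡fibreSize i)
      where
      open ≡-Reasoning
      weight≡fibreSize : ∀ i → ∑ (filterᵇ (λ j → h j ==F i) (allFin m)) (lookup (blockSizes K)) ≡
                               fibreSize (h ∘ block) i
      weight≡fibreSize i = begin
        ∑ (filterᵇ (λ j → h j ==F i) (allFin m)) (lookup (blockSizes K))
          ≡⟨ ∑-filterᵇ _ (allFin m) _ ⟩
        ∑ (allFin m) (λ j → 𝟙 (h j ==F i) * lookup (blockSizes K) j)
          ≡⟨ ∑-cong (allFin m) (λ j →
               cong (𝟙 (h j ==F i) *_) (trans (blockSize≡fibreSize j) (count≡∑𝟙 _ (allFin n)))) ⟩
        ∑ (allFin m) (λ j → 𝟙 (h j ==F i) * ∑ (allFin n) (λ v → 𝟙 (block v ==F j)))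
          ≡⟨ ∑-cong (allFin m) (λ j →
               sym (∑-*ˡ (allFin n) (𝟙 (h j ==F i)) (λ v → 𝟙 (block v ==F j)))) ⟩
        ∑ (allFin m) (λ j → ∑ (allFin n) (λ v → 𝟙 (h j ==F i) * 𝟙 (block v ==F j)))
          ≡⟨ ∑-swap (allFin m) (allFin n) _ ⟩
        ∑ (allFin n) (λ v → ∑ (allFin m) (λ j → 𝟙 (h j ==F i) * 𝟙 (block v ==F j)))
          ≡⟨ ∑-cong (allFin n) (λ v → ∑-cong (allFin m) (λ j → ℕP.*-comm (𝟙 (h j ==F i)) _)) ⟩
        ∑ (allFin n) (λ v → ∑ (allFin m) (λ j → 𝟙 (block v ==F j) * 𝟙 (h j ==F i)))
          ≡⟨ ∑-cong (allFin n) (λ v → ∑-allFin-δ (block v) (λ j → 𝟙 (h j ==F i))) ⟩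
        ∑ (allFin n) (λ v → 𝟙 (h (block v) ==F i))
          ≡⟨ count≡∑𝟙 _ (allFin n) ⟨
        fibreSize (h ∘ block) i ∎

    blockColouringOk : (Fin m → Fin N) → Bool
    blockColouringOk = powerSumColouring (blockSizes K) α

    vertexColouringOk : (Fin n → Fin N) → Bool
    vertexColouringOk f = (K ⊑ ker f) ∧ hasContent α f

    count-blockColourings : count blockColouringOk Hs ≡ count vertexColouringOk Fs
    count-blockColourings = count-bijection Hs Fs
      blockColouringOk vertexColouringOk R unique-right unique-left R⊆ok×ok
      where
      R : (Fin m → Fin N) → (Fin n → Fin N) → Bool
      R h f = blockColouringOk h ∧ (f ≗ᵇ (h ∘ block))

      transfer : ∀ h f → (∀ v → f v ≡ h (block v)) → blockColouringOk h ≡ hasContent α f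
      transfer h f f≡h∘block = trans (powerSumColouring≡hasContent h) (hasContent-cong α (sym ∘ f≡h∘block))

      unique-right : ∀ h → T (blockColouringOk h) → ∑ Fs (λ f → 𝟙 (R h f)) ≡ 1
      unique-right h ok-h = trans
        (∑-cong Fs (λ f → cong (λ b → 𝟙 (b ∧ (f ≗ᵇ (h ∘ block)))) (to T-≡ ok-h)))
        (∑-allFuns-≗ᵇ (h ∘ block))

      unique-left : ∀ f → T (vertexColouringOk f) → ∑ Hs (λ h → 𝟙 (R h f)) ≡ 1
      unique-left f ok-f = trans (∑-cong Hs (cong 𝟙 ∘ R≡)) (∑-allFuns-≗ᵇ (f ∘ rep))
        where
        K⊑f : T (K ⊑ ker f)
        K⊑f = proj₁ (to (T-∧ {K ⊑ ker f}) ok-f)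
        content-f : T (hasContent α f)
        content-f = proj₂ (to (T-∧ {K ⊑ ker f}) ok-f)
        R≡ : ∀ h → R h f ≡ (h ≗ᵇ (f ∘ rep))
        R≡ h = T-injective
          (λ r → ≗⇒≗ᵇ λ j → trans (cong h (sym (block-rep j)))
                                  (sym (≗ᵇ⇒≗ {f = f} (proj₂ (to (T-∧ {blockColouringOk h}) r)) (rep j))))
          (λ h≗f∘rep → let f≡h∘block v = trans (⊑ker⁻ K f K⊑f (K-rep-block v))
                                                (sym (≗ᵇ⇒≗ {f = h} h≗f∘rep (block v))) in
            from T-∧ (subst T (sym (transfer h f f≡h∘block)) content-f , ≗⇒≗ᵇ f≡h∘block))

      R⊆ok×ok : ∀ h f → T (R h f) → T (blockColouringOk h) × T (vertexColouringOk f)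
      R⊆ok×ok h f r =
        ok-h , from T-∧ (⊑⁺ K (ker f) (≡⇒==F ∘ constant) , subst T (transfer h f f≡h∘block) ok-h)
        where
        ok-h : T (blockColouringOk h)
        ok-h = proj₁ (to (T-∧ {blockColouringOk h}) r)
        f≡h∘block : ∀ v → f v ≡ h (block v)
        f≡h∘block = ≗ᵇ⇒≗ {f = f} (proj₂ (to (T-∧ {blockColouringOk h}) r))
        constant : ∀ {x y} → ⟦ K ⟧ x y → f x ≡ f y
        constant K-xy = trans (f≡h∘block _) (trans (cong h (K⇒block≡ K-xy)) (sym (f≡h∘block _)))

    coeffP-blockSizes : coeffP (blockSizes K) α ≡
                        ∑ℤ Fs (λ f → 𝟙ℤ (K ⊑ ker f) *ℤ 𝟙ℤ (hasContent α f))
    coeffP-blockSizes = begin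
      coeffP (blockSizes K) α                                ≡⟨ coeffP≡count (blockSizes K) α ⟩
      + count blockColouringOk Hs        ≡⟨ cong +_ count-blockColourings ⟩
      + count vertexColouringOk Fs       ≡⟨ +count≡∑𝟙 vertexColouringOk Fs ⟩
      ∑ℤ Fs (𝟙ℤ ∘ vertexColouringOk)
        ≡⟨ Sumℤ.∑-cong Fs (λ f → Sumℤ.𝟙-∧ (K ⊑ ker f) (hasContent α f)) ⟩
      ∑ℤ Fs (λ f → 𝟙ℤ (K ⊑ ker f) *ℤ 𝟙ℤ (hasContent α f)) ∎
      where open ≡-Reasoning

-- Walks inside blocks

module Walks {n : ℕ} (g : SimpleGraph n) where

  data Walk (K : Rel n) (x : Fin n) : ℕ → Fin n → Set where
    done : ∀ {k} → Walk K x k x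
    step : ∀ {k y z} → Walk K x k z → ⟦ K ⟧ x y → T (adj g z y) → Walk K x (suc k) y

  private variable
    k k′ : ℕ
    K K′ : Rel n
    x y z : Fin n

  adj-sym : ∀ {x y} → T (adj g x y) → T (adj g y x)
  adj-sym {x} {y} = subst T (SimpleGraph.sym g x y)

  adj-irrefl : ∀ {x} → ¬ T (adj g x x)
  adj-irrefl {x} = subst T (SimpleGraph.irrefl g x)

  reachable : Rel n → Rel n
  reachable K x y = reach g n K x y

  walk-suc : Walk K x k y → Walk K x (suc k) y
  walk-suc done            = done
  walk-suc (step w K-xy a) = step (walk-suc w) K-xy a

  reach⇒walk : ∀ k → T (reach g k K x y) → Walk K x k y
  reach⇒walk {x = x} zero    r = subst (Walk _ x 0) (==F⇒≡ {x = x} r) done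
  reach⇒walk {K} {x} {y} (suc k) r with to (T-∨ {reach g k K x y}) r
  ... | inj₁ r′ = walk-suc (reach⇒walk k r′)
  ... | inj₂ ∃z with anyF⁻ {p = λ z → reach g k K x z ∧ K x y ∧ adj g z y} ∃z
  ...   | z , h with to (T-∧ {reach g k K x z}) h
  ...     | r′ , K-xy∧a = let K-xy , a = to (T-∧ {K x y}) K-xy∧a in step (reach⇒walk k r′) K-xy a

  walk⇒reach : Walk K x k y → T (reach g k K x y)
  walk⇒reach {K} {x} {k} done = reach-refl k
    where
    reach-refl : ∀ k → T (reach g k K x x)
    reach-refl zero    = ≡⇒==F {x = x} refl
    reach-refl (suc k) = from T-∨ (inj₁ (reach-refl k))
  walk⇒reach {K} {x} {suc k} {y} (step {z = z} w K-xy a) =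
    from (T-∨ {reach g k K x y}) (inj₂ (anyF⁺ {p = λ z → reach g k K x z ∧ K x y ∧ adj g z y} z
      (from T-∧ (walk⇒reach w , from T-∧ (K-xy , a)))))

  walk-mono : k ≤ k′ → Walk K x k y → Walk K x k′ y
  walk-mono _          done            = done
  walk-mono (s≤s k≤k′) (step w K-xy a) = step (walk-mono k≤k′ w) K-xy a

  walk-monoᴿ : ⟦ K ⟧ ⇒ ⟦ K′ ⟧ → Walk K x k y → Walk K′ x k y
  walk-monoᴿ K⇒K′ done            = done
  walk-monoᴿ K⇒K′ (step w K-xy a) = step (walk-monoᴿ K⇒K′ w) (K⇒K′ K-xy) a

  walk⇒K : (∀ {x} → ⟦ K ⟧ x x) → Walk K x k y → ⟦ K ⟧ x y
  walk⇒K K-refl done           = K-refl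
  walk⇒K K-refl (step _ K-xy _) = K-xy

  edge⇒walk : ⟦ K ⟧ x y → T (adj g x y) → Walk K x n y
  edge⇒walk {x = x} K-xy a =
    walk-mono (ℕP.≤-trans (s≤s z≤n) (FinP.toℕ<n x)) (step (done {k = 0}) K-xy a)

  -- The sets of vertices reachable from x grow strictly until they stabilise, and they have at
  -- most n elements, so walks of any length can be shortened to length n.
  module _ {x : Fin n} (K : Rel n) where

    Stable : ℕ → Set
    Stable k = ∀ {y} → Walk K x (suc k) y → Walk K x k y

    stable-suc : Stable k → Stable (suc k)
    stable-suc stable done            = done
    stable-suc stable (step w K-xy a) = step (stable w) K-xy a

    stable-+ : Stable k → ∀ j → Stable (j + k)
    stable-+ stable zero    = stable
    stable-+ stable (suc j) = stable-suc (stable-+ stable j)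

    stable-shorten : Stable k → ∀ j → Walk K x (j + k) y → Walk K x k y
    stable-shorten stable zero    w = w
    stable-shorten stable (suc j) w = stable-shorten stable j (stable-+ stable j w)

    stable-or-grows : ∀ k → Stable k ⊎ k < countFin n (reach g k K x)
    stable-or-grows zero    =
      inj₂ (ℕP.≤-reflexive (sym (trans (count-cong (allFin n) (==F-sym x)) (count-==F x))))
    stable-or-grows (suc k) with stable-or-grows k
    ... | inj₁ stable = inj₁ (stable-suc stable)
    ... | inj₂ k<count with FinP.any? (λ y → T? (reach g (suc k) K x y ∧ not (reach g k K x y)))
    ...   | yes (y , new) = inj₂ (ℕP.<-≤-trans (s≤s k<count)
      (count-strict-mono (allFin n) (walk⇒reach ∘ walk-suc ∘ reach⇒walk k) (∈-allFin y)
         (proj₁ (to T-∧ new)) (T-not⁻ (proj₂ (to (T-∧ {reach g (suc k) K x y}) new)))))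
    ...   | no ¬new = inj₁ (stable-suc stable)
      where
      stable : Stable k
      stable {y} w with T? (reach g k K x y)
      ... | yes r = reach⇒walk k r
      ... | no ¬r = ⊥-elim (¬new (y , from T-∧ (walk⇒reach w , T-not⁺ ¬r)))

    stable-at-n : Stable n
    stable-at-n with stable-or-grows n
    ... | inj₁ stable = stable
    ... | inj₂ n<count = ⊥-elim (ℕP.<-irrefl refl (ℕP.<-≤-trans n<count (countFin≤n _)))

    walk-shorten : Walk K x k y → Walk K x n y
    walk-shorten {k} w with k ℕP.≤? n
    ... | yes k≤n = walk-mono k≤n w
    ... | no  k≰n =
      stable-shorten stable-at-n (k ∸ n) (subst (λ l → Walk K x l _) (sym (ℕP.m∸n+n≡m n≤k)) w)
      where n≤k = ℕP.<⇒≤ (ℕP.≰⇒> k≰n)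

  walk-reachable : Walk K x k y → Walk (reachable K) x k y
  walk-reachable done              = done
  walk-reachable w@(step w′ K-xy a) = step (walk-reachable w′) (walk⇒reach (walk-shorten _ w)) a

  module _ {K : Rel n} (K-equiv : IsEquivalence ⟦ K ⟧) where

    open IsEquivalence K-equiv renaming (refl to K-refl; sym to K-sym; trans to K-trans)

    walk-++ : ∀ {a b} → Walk K x a y → Walk K y b z → Walk K x (b + a) z
    walk-++ {a = a} {b} w done = walk-mono (ℕP.m≤n+m a b) w
    walk-++ w (step w′ K-yz a) = step (walk-++ w w′) (K-trans (walk⇒K K-refl w) K-yz) a

    walk-reverse : Walk K x k y → Walk K y k x
    walk-reverse done = done
    walk-reverse {x = x} {k = suc k} {y = y} (step {z = z} w K-xy a) =
      subst (λ l → Walk K y l x) (ℕP.+-comm k 1) (walk-++ first-edge (walk-reverse w))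
      where
      first-edge : Walk K y 1 z
      first-edge = step done (K-trans (K-sym K-xy) (walk⇒K K-refl w)) (adj-sym a)

    reachable-isEquivalence : IsEquivalence ⟦ reachable K ⟧
    reachable-isEquivalence = record
      { refl  = walk⇒reach (done {k = n})
      ; sym   = walk⇒reach ∘ walk-reverse ∘ reach⇒walk n
      ; trans = λ r r′ → walk⇒reach (walk-shorten K (walk-++ (reach⇒walk n r) (reach⇒walk n r′)))
      }

-- The poset L

module Poset {n : ℕ} (g : SimpleGraph n) where

  open Walks g

  record IsMatchingPartition (M : Rel n) : Set where
    field
      isEquivalence : IsEquivalence ⟦ M ⟧
      pairs         : ∀ x → countFin n (M x) ≡ 2
      edges         : ∀ {x y} → ⟦ M ⟧ x y → x ≢ y → T (adj g x y)

  private
    pairsᵇ edgesᵇ : Rel n → Bool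
    pairsᵇ M = allF n (λ x → countFin n (M x) ≡ᵇ 2)
    edgesᵇ M = allF n (λ x → allF n (λ y → (M x y ∧ not (x ==F y)) ⇒ᵇ adj g x y))

  isMatchingPartition⁻ : (M : Rel n) → T (isMatchingPartition g M) → IsMatchingPartition M
  isMatchingPartition⁻ M h = record
    { isEquivalence = isEquiv⁻ M (proj₁ (to (T-∧ {isEquiv M}) h))
    ; pairs = λ x → ℕP.≡ᵇ⇒≡ _ 2 (allF⁻ {p = λ x → countFin n (M x) ≡ᵇ 2} pairs-h x)
    ; edges = λ {x} {y} M-xy x≢y →
        ⇒ᵇ⁻ (allF⁻ {p = λ y → (M x y ∧ not (x ==F y)) ⇒ᵇ adj g x y} (allF⁻ edges-h x) y)
            (from T-∧ (M-xy , T-not⁺ (x≢y ∘ ==F⇒≡)))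
    }
    where
    pairs-h : T (pairsᵇ M)
    pairs-h = proj₁ (to (T-∧ {pairsᵇ M}) (proj₂ (to (T-∧ {isEquiv M}) h)))
    edges-h : T (edgesᵇ M)
    edges-h = proj₂ (to (T-∧ {pairsᵇ M}) (proj₂ (to (T-∧ {isEquiv M}) h)))

  isMatchingPartition⁺ : (M : Rel n) → IsMatchingPartition M → T (isMatchingPartition g M)
  isMatchingPartition⁺ M m = from (T-∧ {isEquiv M}) (isEquiv⁺ M isEquivalence , from (T-∧ {pairsᵇ M})
    ( allF⁺ {p = λ x → countFin n (M x) ≡ᵇ 2} (λ x → ℕP.≡⇒≡ᵇ _ 2 (pairs x))
    , allF⁺ {p = λ x → allF n (λ y → (M x y ∧ not (x ==F y)) ⇒ᵇ adj g x y)} (λ x →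
        allF⁺ {p = λ y → (M x y ∧ not (x ==F y)) ⇒ᵇ adj g x y} (λ y → ⇒ᵇ⁺ λ h →
          let M-xy , x≠y = to (T-∧ {M x y}) h in edges M-xy (T-not⁻ x≠y ∘ ≡⇒==F)))))
    where open IsMatchingPartition m

  isMatchingPartition-resp : ∀ {M M′} → (∀ x y → M x y ≡ M′ x y) →
                             IsMatchingPartition M → IsMatchingPartition M′
  isMatchingPartition-resp {M} {M′} M≐M′ m = record
    { isEquivalence = record
        { refl  = M⇒M′ refl′
        ; sym   = M⇒M′ ∘ sym′ ∘ M′⇒M
        ; trans = λ p q → M⇒M′ (trans′ (M′⇒M p) (M′⇒M q))
        }
    ; pairs         = λ x → trans (count-cong (allFin n) (sym ∘ M≐M′ x)) (pairs x)
    ; edges         = edges ∘ M′⇒M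
    }
    where
    open IsMatchingPartition m
    open IsEquivalence isEquivalence renaming (refl to refl′; sym to sym′; trans to trans′)
    M⇒M′ : ⟦ M ⟧ ⇒ ⟦ M′ ⟧
    M⇒M′ {x} {y} = subst T (M≐M′ x y)
    M′⇒M : ⟦ M′ ⟧ ⇒ ⟦ M ⟧
    M′⇒M {x} {y} = subst T (sym (M≐M′ x y))

  module _ {M : Rel n} (m : IsMatchingPartition M) where

    open IsMatchingPartition m

    count-mate : ∀ x → countFin n (λ u → M x u ∧ not (u ==F x)) ≡ 1
    count-mate x =
      ℕP.suc-injective (trans (sym (count-remove (M x) (IsEquivalence.refl isEquivalence))) (pairs x))

    mate : ∀ x → ∃[ z ] ⟦ M ⟧ x z × z ≢ x
    mate x with countFin-witness _ (ℕP.≤-reflexive (sym (count-mate x)))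
    ... | z , h = let M-xz , z≠x = to (T-∧ {M x z}) h in z , M-xz , T-not⁻ z≠x ∘ ≡⇒==F

  Connected : Rel n → Set
  Connected K = ⟦ K ⟧ ⇒ ⟦ reachable K ⟧

  -- The matching is kept as a member of the enumeration allRels n: lacking function
  -- extensionality, only such relations can be shown to belong to Lgg g.
  record InL (K : Rel n) : Set where
    field
      isEquivalence : IsEquivalence ⟦ K ⟧
      matching      : Rel n
      matching∈     : matching ∈ allRels n
      isMatching    : IsMatchingPartition matching
      matching⊑     : ⟦ matching ⟧ ⇒ ⟦ K ⟧
      connected     : Connected K

  private
    hasMatchingBelowᵇ : Rel n → Bool
    hasMatchingBelowᵇ K = any (λ M → isMatchingPartition g M ∧ (M ⊑ K)) (allRels n)

  inL⁻ : (K : Rel n) → T (inL g K) → InL K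
  inL⁻ K h with to (T-∧ {isEquiv K}) h
  ... | equiv , rest with to (T-∧ {hasMatchingBelowᵇ K}) rest
  ... | below , connected with find (any⁻ _ (allRels n) below)
  ... | M , M∈ , M-ok = record
    { isEquivalence = isEquiv⁻ K equiv
    ; matching      = M
    ; matching∈     = M∈
    ; isMatching    = isMatchingPartition⁻ M (proj₁ (to (T-∧ {isMatchingPartition g M}) M-ok))
    ; matching⊑     = ⊑⁻ M K (proj₂ (to (T-∧ {isMatchingPartition g M}) M-ok))
    ; connected     = λ {x} {y} →
        ⇒ᵇ⁻ (allF⁻ {p = λ y → K x y ⇒ᵇ reach g n K x y}
              (allF⁻ {p = λ x → allF n (λ y → K x y ⇒ᵇ reach g n K x y)} connected x) y)
    }

  inL⁺ : (K : Rel n) → InL K → T (inL g K)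
  inL⁺ K k = from (T-∧ {isEquiv K}) (isEquiv⁺ K isEquivalence , from (T-∧ {hasMatchingBelowᵇ K})
    ( any⁺ _ (lose matching∈
        (from T-∧ (isMatchingPartition⁺ matching isMatching , ⊑⁺ matching K matching⊑)))
    , allF⁺ {p = λ x → allF n (λ y → K x y ⇒ᵇ reach g n K x y)} (λ x →
        allF⁺ {p = λ y → K x y ⇒ᵇ reach g n K x y} (λ y → ⇒ᵇ⁺ connected))))
    where open InL k

  ∈Lgg⁻ : ∀ {K} → K ∈ Lgg g → T (inL g K)
  ∈Lgg⁻ K∈ = proj₂ (∈-filter⁻ (T? ∘ inL g) {xs = allRels n} K∈)

  ∈Lgg-isEquivalence : ∀ {K} → K ∈ Lgg g → IsEquivalence ⟦ K ⟧
  ∈Lgg-isEquivalence {K} K∈ = InL.isEquivalence (inL⁻ K (∈Lgg⁻ K∈))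

  ∈Lgg⁺ : ∀ {K} → K ∈ allRels n → T (inL g K) → K ∈ Lgg g
  ∈Lgg⁺ = ∈-filter⁺ (T? ∘ inL g)

  matchingPartition-inL : ∀ {M} → M ∈ allRels n → IsMatchingPartition M → T (inL g M)
  matchingPartition-inL {M} M∈ m = inL⁺ M record
    { isEquivalence = isEquivalence
    ; matching      = M
    ; matching∈     = M∈
    ; isMatching    = m
    ; matching⊑     = id
    ; connected     = λ {x} {y} M-xy → walk⇒reach (connected M-xy)
    }
    where
    open IsMatchingPartition m
    connected : ∀ {x y} → ⟦ M ⟧ x y → Walk M x n y
    connected {x} {y} M-xy with x FinP.≟ y
    ... | yes refl = done
    ... | no  x≢y  = edge⇒walk M-xy (edges M-xy x≢y)

  module _ {K : Rel n} where

    private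
      belowᵇ : Rel n → Bool
      belowᵇ K′ = (K′ ⊑ K) ⇒ᵇ (K′ ==R K)

    isMinimalL⁻ : T (isMinimalL g K) → ∀ {K′} → K′ ∈ Lgg g → T (K′ ⊑ K) → T (K ⊑ K′)
    isMinimalL⁻ h K′∈ K′⊑K =
      proj₂ (to T-∧ (⇒ᵇ⁻ (All.lookup (all⁺ belowᵇ (Lgg g) (proj₂ (to (T-∧ {inL g K}) h))) K′∈)
                         K′⊑K))

    isMinimalL⁺ : T (inL g K) → (∀ {K′} → K′ ∈ Lgg g → T (K′ ⊑ K) → T (K ⊑ K′)) →
                  T (isMinimalL g K)
    isMinimalL⁺ K∈L minimal =
      from T-∧ (K∈L , all⁻ belowᵇ (All.tabulate λ K′∈ → ⇒ᵇ⁺ λ K′⊑K →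
        from T-∧ (K′⊑K , minimal K′∈ K′⊑K)))

-- Summing ν below the kernel of a colouring

module BelowKernel {n : ℕ} (g : SimpleGraph n) (ν : Rel n → ℤ) (isNu : IsNu g ν)
                   {N : ℕ} (f : Fin n → Fin N) where

  open Walks g
  open Poset g

  P : Rel n
  P = ker f

  open IsEquivalence (ker-isEquivalence f) renaming (refl to P-refl; sym to P-sym; trans to P-trans)

  module Matching (matched : T (matchingColouring g f)) where

    sameColourNeighbour-unique : ∀ v {a b} → ⟦ P ⟧ v a → T (adj g v a) →
                                 ⟦ P ⟧ v b → T (adj g v b) → a ≡ b
    sameColourNeighbour-unique v P-va va P-vb vb =
      count≡1-unique _ (ℕP.≡ᵇ⇒≡ _ 1 (allF⁻ matched v))
        (from T-∧ (P-sym P-va , va)) (from T-∧ (P-sym P-vb , vb))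

    M : Rel n
    M x y = (x ==F y) ∨ ((f y ==F f x) ∧ adj g x y)

    M⁻ : ∀ {x y} → ⟦ M ⟧ x y → x ≡ y ⊎ (⟦ P ⟧ x y × T (adj g x y))
    M⁻ {x} {y} h with to (T-∨ {x ==F y}) h
    ... | inj₁ x=y = inj₁ (==F⇒≡ x=y)
    ... | inj₂ h′  = let P-yx , xy = to (T-∧ {f y ==F f x}) h′ in inj₂ (P-sym P-yx , xy)

    M-refl : ∀ {x} → ⟦ M ⟧ x x
    M-refl {x} = from T-∨ (inj₁ (≡⇒==F {x = x} refl))

    M-edge : ∀ {x y} → ⟦ P ⟧ x y → T (adj g x y) → ⟦ M ⟧ x y
    M-edge {x} P-xy xy = from (T-∨ {x ==F _}) (inj₂ (from T-∧ (P-sym P-xy , xy)))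

    M⊆P : ⟦ M ⟧ ⇒ ⟦ P ⟧
    M⊆P h with M⁻ h
    ... | inj₁ refl         = P-refl
    ... | inj₂ (P-xy , _)  = P-xy

    -- A walk inside a colour class can never leave a vertex and its unique neighbour of the
    -- same colour.
    walk⇒M : ∀ {k x y} → Walk P x k y → ⟦ M ⟧ x y
    walk⇒M done = M-refl
    walk⇒M {x = x} (step w P-xy zy) with M⁻ (walk⇒M w)
    ... | inj₁ refl             = M-edge P-xy zy
    ... | inj₂ (P-xz , xz)      =
      subst (⟦ M ⟧ x) (sym (sameColourNeighbour-unique _ (P-trans (P-sym P-xz) P-xy) zy
                                                          (P-sym P-xz) (adj-sym xz))) M-refl

    M-isMatchingPartition : IsMatchingPartition M
    M-isMatchingPartition = record
      { isEquivalence = record { refl = M-refl ; sym = M-sym ; trans = M-trans }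
      ; pairs         = λ x → trans (count-remove (M x) M-refl) (cong suc
                          (trans (count-cong (allFin n) (mate≐ x)) (ℕP.≡ᵇ⇒≡ _ 1 (allF⁻ matched x))))
      ; edges         = λ h x≢y → [ (λ x≡y → ⊥-elim (x≢y x≡y)) , proj₂ ]′ (M⁻ h)
      }
      where
      M-sym : ∀ {x y} → ⟦ M ⟧ x y → ⟦ M ⟧ y x
      M-sym h with M⁻ h
      ... | inj₁ refl         = M-refl
      ... | inj₂ (P-xy , xy)  = M-edge (P-sym P-xy) (adj-sym xy)
      M-trans : ∀ {x y z} → ⟦ M ⟧ x y → ⟦ M ⟧ y z → ⟦ M ⟧ x z
      M-trans h h′ with M⁻ h | M⁻ h′
      ... | inj₁ refl | _ = h′
      ... | inj₂ _ | inj₁ refl = h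
      ... | inj₂ (P-xy , xy) | inj₂ (P-yz , yz) =
        subst (⟦ M ⟧ _) (sameColourNeighbour-unique _ (P-sym P-xy) (adj-sym xy) P-yz yz) M-refl
      mate≐ : ∀ x u → (M x u ∧ not (u ==F x)) ≡ ((f u ==F f x) ∧ adj g x u)
      mate≐ x u = T-injective
        (λ h → let M-xu , u≠x = to (T-∧ {M x u}) h in
          [ (λ x≡u → ⊥-elim (T-not⁻ u≠x (≡⇒==F (sym x≡u))))
          , (λ { (P-xu , xu) → from T-∧ (P-sym P-xu , xu) }) ]′ (M⁻ M-xu))
        (λ h → let P-ux , xu = to (T-∧ {f u ==F f x}) h in
          from T-∧ ( M-edge (P-sym P-ux) xu
                   , T-not⁺ (λ u=x → adj-irrefl (subst (T ∘ adj g x) (==F⇒≡ u=x) xu))))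

    below-P⇒≐M : ∀ {K} → T (inL g K) → T (K ⊑ P) → ∀ x y → K x y ≡ M x y
    below-P⇒≐M {K} K∈L K⊑P x y = T-injective K⇒M M⇒K
      where
      open InL (inL⁻ K K∈L)
      K⇒M : ⟦ K ⟧ x y → ⟦ M ⟧ x y
      K⇒M K-xy = walk⇒M (walk-monoᴿ (⊑⁻ K P K⊑P) (reach⇒walk n (connected K-xy)))
      M⇒K : ⟦ M ⟧ x y → ⟦ K ⟧ x y
      M⇒K h with M⁻ h | mate isMatching x
      ... | inj₁ refl        | _ = IsEquivalence.refl isEquivalence
      ... | inj₂ (P-xy , xy) | z , matching-xz , z≢x = subst (⟦ K ⟧ x) (sym y≡z) K-xz
        where
        K-xz : ⟦ K ⟧ x z
        K-xz = matching⊑ matching-xz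
        y≡z : y ≡ z
        y≡z = sameColourNeighbour-unique x P-xy xy (⊑⁻ K P K⊑P K-xz)
                (IsMatchingPartition.edges isMatching matching-xz (z≢x ∘ sym))

    ≐M⇒inL : ∀ {K} → K ∈ allRels n → (∀ x y → K x y ≡ M x y) → T (inL g K)
    ≐M⇒inL K∈ K≐M =
      matchingPartition-inL K∈ (isMatchingPartition-resp (λ x y → sym (K≐M x y)) M-isMatchingPartition)

    ≐M⇒isMinimal : ∀ {K} → K ∈ Lgg g → (∀ x y → K x y ≡ M x y) → T (isMinimalL g K)
    ≐M⇒isMinimal {K} K∈ K≐M = isMinimalL⁺ (∈Lgg⁻ K∈) λ {K′} K′∈ K′⊑K →
      let K′≐M = below-P⇒≐M (∈Lgg⁻ K′∈)
                   (⊑⁺ K′ P (λ {x} {y} → M⊆P ∘ subst T (K≐M x y) ∘ ⊑⁻ K′ K K′⊑K))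
      in ⊑⁺ K K′ (λ {x} {y} → subst T (sym (K′≐M x y)) ∘ subst T (K≐M x y))

    ∑ν-below-P : ∑ℤ (Lgg g) (λ K → ν K *ℤ 𝟙ℤ (K ⊑ P)) ≡ + 1
    ∑ν-below-P = begin
      ∑ℤ (Lgg g) (λ K → ν K *ℤ 𝟙ℤ (K ⊑ P))              ≡⟨ Sumℤ.∑-cong∈ (Lgg g) term≡𝟙 ⟩
      ∑ℤ (Lgg g) (λ K → + 𝟙 (K ≐ᵇ M))                   ≡⟨ +-∑ (Lgg g) _ ⟨
      + ∑ (Lgg g) (λ K → 𝟙 (K ≐ᵇ M))                    ≡⟨ cong +_ (∑-filterᵇ (inL g) (allRels n) _) ⟩
      + ∑ (allRels n) (λ K → 𝟙 (inL g K) * 𝟙 (K ≐ᵇ M))  ≡⟨ cong +_ (∑-cong∈ (allRels n) inL-redundant) ⟩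
      + ∑ (allRels n) (λ K → 𝟙 (K ≐ᵇ M))                ≡⟨ cong +_ (∑-allRels-≐ᵇ M) ⟩
      + 1                                                ∎
      where
      open ≡-Reasoning
      term≡𝟙 : ∀ {K} → K ∈ Lgg g → ν K *ℤ 𝟙ℤ (K ⊑ P) ≡ + 𝟙 (K ≐ᵇ M)
      term≡𝟙 {K} K∈ with K ≐ᵇ M in K≐M
      ... | true  = begin
        ν K *ℤ 𝟙ℤ (K ⊑ P)  ≡⟨ cong (λ b → ν K *ℤ 𝟙ℤ b) (to T-≡ (⊑⁺ K P (M⊆P ∘ subst T (K≐M′ _ _)))) ⟩
        ν K *ℤ + 1         ≡⟨ ℤP.*-identityʳ (ν K) ⟩
        ν K                ≡⟨ proj₁ isNu K (≐M⇒isMinimal K∈ K≐M′) ⟩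
        + 1                ∎
        where
        K≐M′ : ∀ x y → K x y ≡ M x y
        K≐M′ = ≐ᵇ⇒≐ (from T-≡ K≐M)
      ... | false = begin
        ν K *ℤ 𝟙ℤ (K ⊑ P)  ≡⟨ cong (λ b → ν K *ℤ 𝟙ℤ b) (¬T⇒≡false K⋢P) ⟩
        ν K *ℤ + 0         ≡⟨ ℤP.*-zeroʳ (ν K) ⟩
        + 0                ∎
        where
        K⋢P : ¬ T (K ⊑ P)
        K⋢P K⊑P = subst T K≐M (≐⇒≐ᵇ (below-P⇒≐M (∈Lgg⁻ K∈) K⊑P))
      inL-redundant : ∀ {K} → K ∈ allRels n → 𝟙 (inL g K) * 𝟙 (K ≐ᵇ M) ≡ 𝟙 (K ≐ᵇ M)
      inL-redundant {K} K∈ with K ≐ᵇ M in K≐M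
      ... | true  = cong (λ b → 𝟙 b * 1) (to T-≡ (≐M⇒inL K∈ (≐ᵇ⇒≐ (from T-≡ K≐M))))
      ... | false = ℕP.*-zeroʳ (𝟙 (inL g K))

  module NotMatching (unmatched : ¬ T (matchingColouring g f)) where

    Q : Rel n
    Q = reachable P

    Q⊆P : ⟦ Q ⟧ ⇒ ⟦ P ⟧
    Q⊆P = walk⇒K P-refl ∘ reach⇒walk n

    ⊑P≡⊑Q : ∀ {K} → T (inL g K) → (K ⊑ P) ≡ (K ⊑ Q)
    ⊑P≡⊑Q {K} K∈L = T-injective
      (λ K⊑P → ⊑⁺ K Q (walk⇒reach ∘ walk-monoᴿ (⊑⁻ K P K⊑P) ∘ reach⇒walk n ∘ connected))
      (λ K⊑Q → ⊑⁺ K P (Q⊆P ∘ ⊑⁻ K Q K⊑Q))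
      where open InL (inL⁻ K K∈L)

    module _ {K₀} (K₀∈ : K₀ ∈ Lgg g) (K₀⊑P : T (K₀ ⊑ P)) where

      open InL (inL⁻ K₀ (∈Lgg⁻ K₀∈)) using (matching; matching∈; isMatching; matching⊑)
      open IsMatchingPartition isMatching using (edges)

      matching⊑Q : ⟦ matching ⟧ ⇒ ⟦ Q ⟧
      matching⊑Q = ⊑⁻ K₀ Q (subst T (⊑P≡⊑Q (∈Lgg⁻ K₀∈)) K₀⊑P) ∘ matching⊑

      Q-inL : T (inL g Q)
      Q-inL = inL⁺ Q record
        { isEquivalence = reachable-isEquivalence (ker-isEquivalence f)
        ; matching      = matching
        ; matching∈     = matching∈
        ; isMatching    = isMatching
        ; matching⊑     = matching⊑Q
        ; connected     = walk⇒reach ∘ walk-reachable ∘ reach⇒walk n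
        }

      Q-notMinimal : ¬ T (isMinimalL g Q)
      Q-notMinimal Q-minimal = unmatched (allF⁺ λ v →
        ℕP.≡⇒≡ᵇ _ 1 (trans (count-cong (allFin n) (neighbour≐mate v)) (count-mate isMatching v)))
        where
        Q⊑matching : ⟦ Q ⟧ ⇒ ⟦ matching ⟧
        Q⊑matching = ⊑⁻ Q matching (isMinimalL⁻ Q-minimal
          (∈Lgg⁺ matching∈ (matchingPartition-inL matching∈ isMatching)) (⊑⁺ matching Q matching⊑Q))
        neighbour≐mate : ∀ v u → ((f u ==F f v) ∧ adj g v u) ≡ (matching v u ∧ not (u ==F v))
        neighbour≐mate v u = T-injective
          (λ h → let P-uv , vu = to (T-∧ {f u ==F f v}) h in
            from T-∧ ( Q⊑matching (walk⇒reach (edge⇒walk (P-sym P-uv) vu))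
                     , T-not⁺ (λ u=v → adj-irrefl (subst (T ∘ adj g v) (==F⇒≡ u=v) vu))))
          (λ h → let matching-vu , u≠v = to (T-∧ {matching v u}) h in
            from T-∧ ( P-sym (⊑⁻ K₀ P K₀⊑P (matching⊑ matching-vu))
                     , edges matching-vu (λ v≡u → T-not⁻ u≠v (≡⇒==F (sym v≡u)))))

      ∑ν-below-P : ∑ℤ (Lgg g) (λ K → ν K *ℤ 𝟙ℤ (K ⊑ P)) ≡ + 0
      ∑ν-below-P = begin
        ∑ℤ (Lgg g) (λ K → ν K *ℤ 𝟙ℤ (K ⊑ P))
          ≡⟨ Sumℤ.∑-cong∈ (Lgg g) (λ {K} K∈ →
               trans (ℤP.*-comm (ν K) _) (cong (λ b → 𝟙ℤ b *ℤ ν K) (⊑P≡⊑Q (∈Lgg⁻ K∈)))) ⟩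
        ∑ℤ (Lgg g) (λ K → 𝟙ℤ (K ⊑ Q) *ℤ ν K)   ≡⟨ Sumℤ.∑-filterᵇ (_⊑ Q) (Lgg g) ν ⟨
        ∑ℤ (filterᵇ (_⊑ Q) (Lgg g)) ν              ≡⟨ proj₂ isNu Q Q-inL Q-notMinimal ⟩
        + 0                                           ∎
        where open ≡-Reasoning

  ∑ν-below-kernel : ∑ℤ (Lgg g) (λ K → ν K *ℤ 𝟙ℤ (K ⊑ P)) ≡ 𝟙ℤ (matchingColouring g f)
  ∑ν-below-kernel with matchingColouring g f in matched
  ... | true  = Matching.∑ν-below-P (from T-≡ matched)
  ... | false with Any.any? (λ K → T? (K ⊑ P)) (Lgg g)
  ...   | yes ∃K =
          let K₀ , K₀∈ , K₀⊑P = find ∃K in NotMatching.∑ν-below-P (subst T matched) K₀∈ K₀⊑P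
  ...   | no ¬∃K = Sumℤ.∑-vanishes (Lgg g) λ {K} K∈ →
          trans (cong (λ b → ν K *ℤ 𝟙ℤ b) (¬T⇒≡false (¬∃K ∘ lose K∈))) (ℤP.*-zeroʳ (ν K))


proposition2p4 : {n : ℕ} (g : SimpleGraph n) (ν : Rel n → ℤ) → IsNu g ν →
                 (α : List ℕ) → coeffΨ g α ≡ coeffRHS g ν α
proposition2p4 {n} g ν isNu α = sym (begin
  ∑ℤ (Lgg g) (λ K → ν K *ℤ coeffP (blockSizes K) α)
    ≡⟨ Sumℤ.∑-cong∈ (Lgg g) (λ {K} K∈ →
         cong (ν K *ℤ_) (Blocks.coeffP-blockSizes K (Poset.∈Lgg-isEquivalence g K∈) α)) ⟩
  ∑ℤ (Lgg g) (λ K → ν K *ℤ ∑ℤ Fs (λ f → 𝟙ℤ (K ⊑ ker f) *ℤ 𝟙ℤ (hasContent α f)))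
    ≡⟨ Sumℤ.∑-distrib-swap (Lgg g) Fs ν (λ K f → 𝟙ℤ (K ⊑ ker f)) (𝟙ℤ ∘ hasContent α) ⟩
  ∑ℤ Fs (λ f → ∑ℤ (Lgg g) (λ K → ν K *ℤ 𝟙ℤ (K ⊑ ker f)) *ℤ 𝟙ℤ (hasContent α f))
    ≡⟨ Sumℤ.∑-cong Fs (λ f →
         cong (_*ℤ 𝟙ℤ (hasContent α f)) (BelowKernel.∑ν-below-kernel g ν isNu f)) ⟩
  ∑ℤ Fs (λ f → 𝟙ℤ (matchingColouring g f) *ℤ 𝟙ℤ (hasContent α f))
    ≡⟨ Sumℤ.∑-cong Fs (λ f → trans (ℤP.*-comm (𝟙ℤ (matchingColouring g f)) _)
                                   (sym (Sumℤ.𝟙-∧ (hasContent α f) (matchingColouring g f)))) ⟩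
  ∑ℤ Fs (𝟙ℤ ∘ okOrdered g α)
    ≡⟨ +count≡∑𝟙 (okOrdered g α) Fs ⟨
  + c g α
    ≡⟨ coeffΨ≡c g α ⟨
  coeffΨ g α ∎)
  where
  open ≡-Reasoning
  Fs : List (Fin n → Fin (length α))
  Fs = allFuns n (allFin (length α))
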